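{- For every integer $n \geq 2$, the following polynomial identity in $x$ holds: $$\sum_{k=1}^{n-1} (n-k)\,E(n-1,k-1)\,x^{k-1}=\sum_{\ell=1}^{n-1} O_2(n,\ell)\,(x-1)^{n-\ell-1}.$$
   Context: For $m \geq 1$ and $j \geq 0$, $E(m,j)$ denotes the Eulerian number: the number of permutations $\pi=\pi_1\cdots\pi_m$ of $[m]=\{1,\ldots,m\}$ (in one-line notation) with exactly $j$ ascents, where an ascent is an index $i \in [m-1]$ with $\pi_i<\pi_{i+1}$. For $n,\ell \geq 1$, $O_2(n,\ell)$ denotes the number of ordered partitions of $[n]$ into $\ell$ non-empty blocks (i.e. sequences $(P_1,\ldots,P_\ell)$ of non-empty pairwise disjoint sets with union $[n]$) in which the first block $P_1$ has size at least $2$. -}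

module Defs where

open import Data.Nat using (ℕ; zero; suc; _∸_; _<ᵇ_; _≤_; _≤?_)
import Data.Nat as ℕ
open import Data.Bool using (if_then_else_)
open import Data.List using (List; []; _∷_; [_]; map; concatMap; filter; length; upTo; foldr)
open import Data.List.Relation.Unary.All using (All; all?)
open import Data.Product using (_×_)
open import Relation.Nullary.Decidable using (_×-dec_)
open import Relation.Binary.PropositionalEquality using (_≡_)
open import Data.List.Relation.Unary.Unique.DecPropositional ℕ._≟_ using (Unique; unique?)
open import Data.List.Membership.DecPropositional ℕ._≟_ using (_∈_; _∈?_)
open import Data.Integer using (ℤ; +_; _+_; _*_; _-_; _^_)

[_]ₙ : ℕ → List ℕ
[ m ]ₙ = map suc (upTo m)

seqs : List ℕ → ℕ → List (List ℕ)
seqs xs zero    = [ [] ]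
seqs xs (suc k) = concatMap (λ x → map (x ∷_) (seqs xs k)) xs

ascents : List ℕ → ℕ
ascents (a ∷ b ∷ r) = (if a <ᵇ b then 1 else 0) ℕ.+ ascents (b ∷ r)
ascents _           = 0

-- a permutation of [m] in one-line notation: a word of length m over [m]
-- with pairwise distinct letters
-- Eulerian number E(m,j): number of permutations of [m] with exactly j ascents
E : ℕ → ℕ → ℕ
E m j = length (filter (λ p → unique? p ×-dec (ascents p ℕ.≟ j)) (seqs [ m ]ₙ m))

-- An ordered partition (P₁,…,P_ℓ) of [n] into ℓ non-empty blocks is encoded by
-- the word f₁⋯f_n over [ℓ] where fᵢ is the index of the block containing i.
-- Blocks non-empty ⇔ every b ∈ [ℓ] occurs in the word; |P₁| = #occurrences of 1.
blockSize : ℕ → List ℕ → ℕ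
blockSize b f = length (filter (ℕ._≟ b) f)

O₂ : ℕ → ℕ → ℕ
O₂ n ℓ = length (filter (λ f → all? (_∈? f) [ ℓ ]ₙ ×-dec (2 ≤? blockSize 1 f)) (seqs [ ℓ ]ₙ n))

∑[1‥_] : ℕ → (ℕ → ℤ) → ℤ
∑[1‥ m ] t = foldr (λ k acc → t k + acc) (+ 0) [ m ]ₙ

LHS : ℕ → ℤ → ℤ
LHS n x = ∑[1‥ n ∸ 1 ] (λ k → + (n ∸ k) * + E (n ∸ 1) (k ∸ 1) * x ^ (k ∸ 1))

RHS : ℕ → ℤ → ℤ
RHS n x = ∑[1‥ n ∸ 1 ] (λ ℓ → + O₂ n ℓ * (x - + 1) ^ (n ∸ ℓ ∸ 1))

-- Put m = n − 1 and y = x − 1, and compare coefficients of yⁱ. Expanding x^s = Σᵢ C(s,i) yⁱ,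
-- the left-hand coefficient is Σ_π (m − asc π) C(asc π, i) over the permutations π of [m].
-- Inserting m + 1 into a permutation of [m] gives the Eulerian recurrence, and with it, by
-- induction on m, Σ_π C(asc π, i) = O(m, m − i), the number of ordered partitions of [m] into
-- m − i blocks.  The absorption identity s C(s,i) = (i+1) C(s,i+1) + i C(s,i) then turns the
-- coefficient into (m − i) O(m, m−i) − (i+1) O(m, m−i−1).  On the right, discarding the
-- ordered partitions whose first block is a singleton gives
-- O₂(m+1, ℓ) = O(m+1, ℓ) − (m+1) O(m, ℓ−1), and the recurrence of O matches the two.
{-# OPTIONS --safe #-}
module Submission where

open import Defs
open import Data.Nat using (ℕ; _≤_)
open import Data.Integer using (ℤ)
open import Relation.Binary.PropositionalEquality using (_≡_)

import Algebra.Properties.AbelianGroup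
import Data.Nat as ℕ
import Data.Nat.Properties as ℕ
open import Data.Bool using (Bool; true; false; if_then_else_; not; _∧_; _∨_)
open import Data.Integer using (0ℤ; 1ℤ; +_; _+_; _*_; _-_; -_; _^_)
import Data.Integer.Properties as ℤ
open import Data.Integer.Tactic.RingSolver using (solve-∀)
open import Data.List using (List; []; _∷_; _++_; map; concatMap; filter; length; foldr; applyUpTo)
open import Data.List.Membership.DecPropositional ℕ._≟_ using (_∈?_)
open import Data.List.Membership.Propositional using (_∈_; _∉_)
open import Data.List.Properties using (map-upTo; filter-accept; filter-reject; filter-all)
open import Data.List.Relation.Binary.Subset.Propositional using (_⊆_)
open import Data.List.Relation.Binary.Subset.Propositional.Properties using (⊆-trans; filter-⊆)
open import Data.List.Relation.Unary.All using (all?)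
import Data.List.Relation.Unary.All as All
open import Data.List.Relation.Unary.All.Properties using (¬Any⇒All¬; All¬⇒¬Any)
open import Data.List.Relation.Unary.Any using (here; there)
open import Data.List.Relation.Unary.Unique.DecPropositional ℕ._≟_ using (unique?)
open import Data.List.Relation.Unary.Unique.Propositional using (Unique; []; _∷_)
import Data.List.Relation.Unary.Unique.Propositional.Properties as Unique
open import Data.Nat using (zero; suc; pred; _<_; _∸_; _<ᵇ_; _≡ᵇ_; z≤n; s≤s)
open import Data.Nat.Combinatorics using (_C_; nC1≡n; nCk+nC[k+1]≡[n+1]C[k+1])
open import Data.Nat.Combinatorics.Specification using (k>n⇒nCk≡0)
open import Data.Nat.Tactic.RingSolver using () renaming (solve-∀ to ℕ-solve-∀)
open import Function using (_∘_)
open import Function.Bundles using (mk⇔)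
open import Relation.Binary.Definitions using (tri<; tri≈; tri>)
open import Relation.Binary.PropositionalEquality using (refl; sym; trans; cong; cong₂; subst; module ≡-Reasoning)
open import Relation.Nullary.Decidable using (Dec; yes; no; does; proof; dec-true; dec-false; does-⇔; ¬?)
open import Relation.Nullary.Negation using (contradiction)
open import Relation.Nullary.Reflects using (Reflects; ofʸ; ofⁿ)

open Algebra.Properties.AbelianGroup ℤ.+-0-abelianGroup using () renaming (∙-cancelʳ to +-cancelʳ)
open ≡-Reasoning

𝟙 : Bool → ℕ
𝟙 t = if t then 1 else 0

module _ {A : Set} where

  ∑ : (A → ℤ) → List A → ℤ
  ∑ f []       = 0ℤ
  ∑ f (x ∷ xs) = f x + ∑ f xs

  infixr 10 ∑
  syntax ∑ (λ x → e) xs = ∑[ x ∈ xs ] e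

  ∑-cong : ∀ {f g : A → ℤ} → (∀ x → f x ≡ g x) → ∀ xs → ∑ f xs ≡ ∑ g xs
  ∑-cong f≗g []       = refl
  ∑-cong f≗g (x ∷ xs) = cong₂ _+_ (f≗g x) (∑-cong f≗g xs)

  ∑-0 : ∀ xs → ∑[ x ∈ xs ] 0ℤ ≡ 0ℤ
  ∑-0 []       = refl
  ∑-0 (x ∷ xs) = trans (ℤ.+-identityˡ _) (∑-0 xs)

  ∑-++ : ∀ (f : A → ℤ) xs ys → ∑ f (xs ++ ys) ≡ ∑ f xs + ∑ f ys
  ∑-++ f []       ys = sym (ℤ.+-identityˡ _)
  ∑-++ f (x ∷ xs) ys = trans (cong (_+_ (f x)) (∑-++ f xs ys)) (sym (ℤ.+-assoc (f x) _ _))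

  ∑-distrib-+ : ∀ (f g : A → ℤ) xs → ∑[ x ∈ xs ] (f x + g x) ≡ ∑ f xs + ∑ g xs
  ∑-distrib-+ f g []       = refl
  ∑-distrib-+ f g (x ∷ xs) = trans (cong (_+_ (f x + g x)) (∑-distrib-+ f g xs)) (interchange (f x) (g x) _ _)
    where
    interchange : ∀ a b c d → a + b + (c + d) ≡ a + c + (b + d)
    interchange = solve-∀

  *-distribˡ-∑ : ∀ c (f : A → ℤ) xs → c * ∑ f xs ≡ ∑[ x ∈ xs ] (c * f x)
  *-distribˡ-∑ c f []       = ℤ.*-zeroʳ c
  *-distribˡ-∑ c f (x ∷ xs) = trans (ℤ.*-distribˡ-+ c (f x) _) (cong (_+_ (c * f x)) (*-distribˡ-∑ c f xs))

  ∑-filter : ∀ {P : A → Set} (P? : ∀ x → Dec (P x)) (f : A → ℤ) xs →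
             ∑ f (filter P? xs) ≡ ∑[ x ∈ xs ] (if does (P? x) then f x else 0ℤ)
  ∑-filter P? f []       = refl
  ∑-filter P? f (x ∷ xs) with does (P? x)
  ... | true  = cong (_+_ (f x)) (∑-filter P? f xs)
  ... | false = trans (∑-filter P? f xs) (sym (ℤ.+-identityˡ _))

  length-filter : ∀ {P : A → Set} (P? : ∀ x → Dec (P x)) xs → + length (filter P? xs) ≡ ∑[ x ∈ xs ] (+ 𝟙 (does (P? x)))
  length-filter P? []       = refl
  length-filter P? (x ∷ xs) with does (P? x)
  ... | true  = cong (_+_ 1ℤ) (length-filter P? xs)
  ... | false = trans (length-filter P? xs) (sym (ℤ.+-identityˡ _))

  ∑-cong-∈ : ∀ {f g : A → ℤ} xs → (∀ x → x ∈ xs → f x ≡ g x) → ∑ f xs ≡ ∑ g xs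
  ∑-cong-∈ []       f≗g = refl
  ∑-cong-∈ (x ∷ xs) f≗g = cong₂ _+_ (f≗g x (here refl)) (∑-cong-∈ xs (λ y y∈xs → f≗g y (there y∈xs)))

  ∑-if : ∀ (b : A → Bool) (u v : ℤ) xs →
         ∑[ x ∈ xs ] (if b x then u else v) ≡ ∑[ x ∈ xs ] (+ 𝟙 (b x)) * u + (+ length xs - ∑[ x ∈ xs ] (+ 𝟙 (b x))) * v
  ∑-if b u v []       = sym (empty u v)
    where
    empty : ∀ u v → 0ℤ * u + (0ℤ - 0ℤ) * v ≡ 0ℤ
    empty = solve-∀
  ∑-if b u v (x ∷ xs) with b x
  ... | true  = trans (cong (_+_ u) (∑-if b u v xs)) (count u v (∑[ x ∈ xs ] (+ 𝟙 (b x))) (+ length xs))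
    where
    count : ∀ u v c l → u + (c * u + (l - c) * v) ≡ (1ℤ + c) * u + (1ℤ + l - (1ℤ + c)) * v
    count = solve-∀
  ... | false = trans (cong (_+_ v) (∑-if b u v xs)) (count u v (∑[ x ∈ xs ] (+ 𝟙 (b x))) (+ length xs))
    where
    count : ∀ u v c l → v + (c * u + (l - c) * v) ≡ (0ℤ + c) * u + (1ℤ + l - (0ℤ + c)) * v
    count = solve-∀

module _ {A B : Set} where

  ∑-map : ∀ (f : B → ℤ) (g : A → B) xs → ∑ f (map g xs) ≡ ∑ (f ∘ g) xs
  ∑-map f g []       = refl
  ∑-map f g (x ∷ xs) = cong (_+_ (f (g x))) (∑-map f g xs)

  ∑-concatMap : ∀ (f : B → ℤ) (g : A → List B) xs → ∑ f (concatMap g xs) ≡ ∑[ x ∈ xs ] ∑ f (g x)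
  ∑-concatMap f g []       = refl
  ∑-concatMap f g (x ∷ xs) = trans (∑-++ f (g x) (concatMap g xs)) (cong (_+_ (∑ f (g x))) (∑-concatMap f g xs))

  ∑-comm : ∀ (F : A → B → ℤ) xs ys → ∑[ x ∈ xs ] ∑[ y ∈ ys ] F x y ≡ ∑[ y ∈ ys ] ∑[ x ∈ xs ] F x y
  ∑-comm F []       ys = sym (∑-0 ys)
  ∑-comm F (x ∷ xs) ys = trans (cong (_+_ (∑ (F x) ys)) (∑-comm F xs ys)) (sym (∑-distrib-+ (F x) _ ys))

range : ℕ → ℕ → List ℕ
range lo zero    = []
range lo (suc n) = lo ∷ range (suc lo) n

∑< : ℕ → (ℕ → ℤ) → ℤ
∑< n f = ∑ f (range 0 n)

infixr 10 ∑<
syntax ∑< n (λ i → e) = ∑[ i < n ] e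

∑-range-suc : ∀ (f : ℕ → ℤ) lo n → ∑ f (range (suc lo) n) ≡ ∑ (f ∘ suc) (range lo n)
∑-range-suc f lo zero    = refl
∑-range-suc f lo (suc n) = cong (_+_ (f (suc lo))) (∑-range-suc f (suc lo) n)

∑-range-∷ʳ : ∀ (f : ℕ → ℤ) lo n → ∑ f (range lo (suc n)) ≡ ∑ f (range lo n) + f (lo ℕ.+ n)
∑-range-∷ʳ f lo zero    = trans (ℤ.+-identityʳ (f lo)) (trans (cong f (sym (ℕ.+-identityʳ lo))) (sym (ℤ.+-identityˡ _)))
∑-range-∷ʳ f lo (suc n) = begin
  f lo + ∑ f (range (suc lo) (suc n))                ≡⟨ cong (_+_ (f lo)) (∑-range-∷ʳ f (suc lo) n) ⟩
  f lo + (∑ f (range (suc lo) n) + f (suc lo ℕ.+ n)) ≡⟨ sym (ℤ.+-assoc (f lo) _ _) ⟩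
  f lo + ∑ f (range (suc lo) n) + f (suc lo ℕ.+ n)   ≡⟨ cong (λ k → f lo + ∑ f (range (suc lo) n) + f k) (sym (ℕ.+-suc lo n)) ⟩
  f lo + ∑ f (range (suc lo) n) + f (lo ℕ.+ suc n)   ∎

∑-range-cong : ∀ {f g : ℕ → ℤ} lo n → (∀ i → lo ≤ i → i < lo ℕ.+ n → f i ≡ g i) →
               ∑ f (range lo n) ≡ ∑ g (range lo n)
∑-range-cong lo zero    f≗g = refl
∑-range-cong lo (suc n) f≗g = cong₂ _+_
  (f≗g lo ℕ.≤-refl (ℕ.m<m+n lo ℕ.z<s))
  (∑-range-cong (suc lo) n (λ i lo<i i<hi → f≗g i (ℕ.<⇒≤ lo<i) (subst (i <_) (sym (ℕ.+-suc lo n)) i<hi)))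

∑<-cong : ∀ n {f g : ℕ → ℤ} → (∀ i → i < n → f i ≡ g i) → ∑< n f ≡ ∑< n g
∑<-cong n f≗g = ∑-range-cong 0 n (λ i _ → f≗g i)

∑<-suc : ∀ n f → ∑< (suc n) f ≡ f 0 + ∑< n (f ∘ suc)
∑<-suc n f = cong (_+_ (f 0)) (∑-range-suc f 0 n)

∑<-∷ʳ : ∀ n f → ∑< (suc n) f ≡ ∑< n f + f n
∑<-∷ʳ n f = ∑-range-∷ʳ f 0 n

∑<-reverse : ∀ n f → ∑< n f ≡ ∑[ i < n ] f (n ∸ suc i)
∑<-reverse zero    f = refl
∑<-reverse (suc n) f = begin
  ∑< (suc n) f                                     ≡⟨ ∑<-suc n f ⟩
  f 0 + ∑< n (f ∘ suc)                             ≡⟨ cong (_+_ (f 0)) (∑<-reverse n (f ∘ suc)) ⟩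
  f 0 + ∑[ i < n ] f (suc (n ∸ suc i))             ≡⟨ ℤ.+-comm (f 0) _ ⟩
  ∑[ i < n ] f (suc (n ∸ suc i)) + f 0             ≡⟨ cong₂ _+_ (∑<-cong n (λ i i<n → cong f (sym (ℕ.+-∸-assoc 1 i<n))))
                                                                (cong f (sym (ℕ.n∸n≡0 n))) ⟩
  ∑[ i < n ] f (suc n ∸ suc i) + f (n ∸ n)          ≡⟨ sym (∑<-∷ʳ n (λ i → f (n ∸ i))) ⟩
  ∑[ i < suc n ] f (suc n ∸ suc i)                 ∎

length-range : ∀ lo n → length (range lo n) ≡ n
length-range lo zero    = refl
length-range lo (suc n) = cong suc (length-range (suc lo) n)

range-< : ∀ {x} lo n → x < lo → x ∉ range lo n
range-< (suc lo) (suc n) x<lo (here x≡lo)  = ℕ.<⇒≢ x<lo x≡lo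
range-< (suc lo) (suc n) x<lo (there x∈)   = range-< (suc (suc lo)) n (ℕ.m<n⇒m<1+n x<lo) x∈
range-< zero     _       ()

Unique-range : ∀ lo n → Unique (range lo n)
Unique-range lo zero    = []
Unique-range lo (suc n) = ¬Any⇒All¬ (range (suc lo) n) (range-< (suc lo) n ℕ.≤-refl) ∷ Unique-range (suc lo) n

[_]ₙ≡range : ∀ m → [ m ]ₙ ≡ range 1 m
[_]ₙ≡range m = trans (map-upTo suc m) (go suc 1 m (λ i → refl))
  where
  go : ∀ (g : ℕ → ℕ) lo n → (∀ i → g i ≡ lo ℕ.+ i) → applyUpTo g n ≡ range lo n
  go g lo zero    g≗ = refl
  go g lo (suc n) g≗ = cong₂ _∷_ (trans (g≗ 0) (ℕ.+-identityʳ lo))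
                                 (go (g ∘ suc) (suc lo) n (λ i → trans (g≗ (suc i)) (ℕ.+-suc lo i)))

∑-seqs-suc : ∀ (f : List ℕ → ℤ) A k → ∑ f (seqs A (suc k)) ≡ ∑[ a ∈ A ] ∑[ w ∈ seqs A k ] f (a ∷ w)
∑-seqs-suc f A k = trans (∑-concatMap f (λ a → map (a ∷_) (seqs A k)) A)
                         (∑-cong (λ a → ∑-map f (a ∷_) (seqs A k)) A)

∑-seqs-map : ∀ (g : ℕ → ℕ) A k (f : List ℕ → ℤ) → ∑ f (seqs (map g A) k) ≡ ∑[ w ∈ seqs A k ] f (map g w)
∑-seqs-map g A zero    f = refl
∑-seqs-map g A (suc k) f = begin
  ∑ f (seqs (map g A) (suc k))                            ≡⟨ ∑-seqs-suc f (map g A) k ⟩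
  ∑[ a ∈ map g A ] ∑[ w ∈ seqs (map g A) k ] f (a ∷ w)     ≡⟨ ∑-map _ g A ⟩
  ∑[ a ∈ A ] ∑[ w ∈ seqs (map g A) k ] f (g a ∷ w)         ≡⟨ ∑-cong (λ a → ∑-seqs-map g A k (λ w → f (g a ∷ w))) A ⟩
  ∑[ a ∈ A ] ∑[ w ∈ seqs A k ] f (g a ∷ map g w)           ≡⟨ sym (∑-seqs-suc (f ∘ map g) A k) ⟩
  ∑[ w ∈ seqs A (suc k) ] f (map g w)                     ∎

fresh : ℕ → List ℕ → Bool
fresh a w = does (all? (λ c → ¬? (a ℕ.≟ c)) w)

uniqueᵇ : List ℕ → Bool
uniqueᵇ w = does (unique? w)

remove : ℕ → List ℕ → List ℕ
remove a = filter (λ c → ¬? (a ℕ.≟ c))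

∑-seqs-fresh : ∀ a A k (f : List ℕ → ℤ) →
               ∑[ w ∈ seqs A k ] (if fresh a w then f w else 0ℤ) ≡ ∑ f (seqs (remove a A) k)
∑-seqs-fresh a A zero    f = refl
∑-seqs-fresh a A (suc k) f = begin
  ∑[ w ∈ seqs A (suc k) ] (if fresh a w then f w else 0ℤ)
    ≡⟨ ∑-seqs-suc _ A k ⟩
  ∑[ c ∈ A ] ∑[ w ∈ seqs A k ] (if not (a ≡ᵇ c) ∧ fresh a w then f (c ∷ w) else 0ℤ)
    ≡⟨ ∑-cong first A ⟩
  ∑[ c ∈ A ] (if not (a ≡ᵇ c) then ∑[ w ∈ seqs (remove a A) k ] f (c ∷ w) else 0ℤ)
    ≡⟨ sym (∑-filter (λ c → ¬? (a ℕ.≟ c)) _ A) ⟩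
  ∑[ c ∈ remove a A ] ∑[ w ∈ seqs (remove a A) k ] f (c ∷ w)
    ≡⟨ sym (∑-seqs-suc f (remove a A) k) ⟩
  ∑ f (seqs (remove a A) (suc k)) ∎
  where
  first : ∀ c → ∑[ w ∈ seqs A k ] (if not (a ≡ᵇ c) ∧ fresh a w then f (c ∷ w) else 0ℤ) ≡
                (if not (a ≡ᵇ c) then ∑[ w ∈ seqs (remove a A) k ] f (c ∷ w) else 0ℤ)
  first c with a ≡ᵇ c
  ... | true  = ∑-0 (seqs A k)
  ... | false = ∑-seqs-fresh a A k (λ w → f (c ∷ w))

module _ (g : ℕ → ℕ) (g-mono : ∀ {c d} → c < d → g c < g d) where

  strictMono-<ᵇ : ∀ c d → (g c <ᵇ g d) ≡ (c <ᵇ d)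
  strictMono-<ᵇ c d = does-⇔ (mk⇔ reflect g-mono) (g c ℕ.<? g d) (c ℕ.<? d)
    where
    reflect : g c < g d → c < d
    reflect gc<gd with ℕ.<-cmp c d
    ... | tri< c<d _ _ = c<d
    ... | tri≈ _ c≡d _ = contradiction gc<gd (ℕ.<-irrefl (cong g c≡d))
    ... | tri> _ _ d<c = contradiction gc<gd (ℕ.<-asym (g-mono d<c))

  strictMono-≡ᵇ : ∀ c d → (g c ≡ᵇ g d) ≡ (c ≡ᵇ d)
  strictMono-≡ᵇ c d = does-⇔ (mk⇔ reflect (cong g)) (g c ℕ.≟ g d) (c ℕ.≟ d)
    where
    reflect : g c ≡ g d → c ≡ d
    reflect gc≡gd with ℕ.<-cmp c d
    ... | tri< c<d _ _ = contradiction gc≡gd (ℕ.<⇒≢ (g-mono c<d))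
    ... | tri≈ _ c≡d _ = c≡d
    ... | tri> _ _ d<c = contradiction (sym gc≡gd) (ℕ.<⇒≢ (g-mono d<c))

  fresh-map : ∀ a w → fresh (g a) (map g w) ≡ fresh a w
  fresh-map a []      = refl
  fresh-map a (c ∷ w) = cong₂ _∧_ (cong not (strictMono-≡ᵇ a c)) (fresh-map a w)

  uniqueᵇ-map : ∀ w → uniqueᵇ (map g w) ≡ uniqueᵇ w
  uniqueᵇ-map []      = refl
  uniqueᵇ-map (a ∷ w) = cong₂ _∧_ (fresh-map a w) (uniqueᵇ-map w)

  ascents-map : ∀ x y → (∀ c → (x <ᵇ g c) ≡ (y <ᵇ c)) → ∀ w → ascents (x ∷ map g w) ≡ ascents (y ∷ w)
  ascents-map x y x≈y []      = refl
  ascents-map x y x≈y (c ∷ w) = cong₂ ℕ._+_ (cong 𝟙 (x≈y c)) (ascents-map (g c) c (strictMono-<ᵇ c) w)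

punchIn : ℕ → ℕ → ℕ
punchIn a c = if c <ᵇ a then c else suc c

punchIn-mono : ∀ a {c d} → c < d → punchIn a c < punchIn a d
punchIn-mono a {c} {d} c<d with c <ᵇ a | ℕ.<ᵇ-reflects-< c a | d <ᵇ a | ℕ.<ᵇ-reflects-< d a
... | true  | _       | true  | _       = c<d
... | true  | _       | false | _       = ℕ.m<n⇒m<1+n c<d
... | false | ofⁿ c≮a | true  | ofʸ d<a = contradiction (ℕ.<-trans c<d d<a) c≮a
... | false | _       | false | _       = s≤s c<d

punchIn-pred : ∀ a c → (suc a <ᵇ punchIn (suc a) c) ≡ (a <ᵇ c)
punchIn-pred a c with c <ᵇ suc a | ℕ.<ᵇ-reflects-< c (suc a)
... | true  | ofʸ c<1+a = trans (dec-false (suc a ℕ.<? c) (ℕ.<⇒≯ c<1+a)) (sym (dec-false (a ℕ.<? c) (ℕ.≤⇒≯ (ℕ.≤-pred c<1+a))))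
... | false | _         = refl

remove-range-below : ∀ a lo n → a < lo → remove a (range lo n) ≡ range lo n
remove-range-below a lo zero    a<lo = refl
remove-range-below a lo (suc n) a<lo = trans (filter-accept (λ c → ¬? (a ℕ.≟ c)) (ℕ.<⇒≢ a<lo))
                                             (cong (lo ∷_) (remove-range-below a (suc lo) n (ℕ.m<n⇒m<1+n a<lo)))

map-punchIn-range-above : ∀ a lo n → a ≤ lo → map (punchIn a) (range lo n) ≡ range (suc lo) n
map-punchIn-range-above a lo zero    a≤lo = refl
map-punchIn-range-above a lo (suc n) a≤lo =
  cong₂ _∷_ (cong (λ t → if t then lo else suc lo) (dec-false (lo ℕ.<? a) (ℕ.≤⇒≯ a≤lo)))
            (map-punchIn-range-above a (suc lo) n (ℕ.m≤n⇒m≤1+n a≤lo))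

remove-range : ∀ a lo n → lo ≤ a → a ≤ lo ℕ.+ n → remove a (range lo (suc n)) ≡ map (punchIn a) (range lo n)
remove-range a lo n lo≤a a≤hi with a ℕ.≟ lo
remove-range a .a n _ _ | yes refl = begin
  remove a (range a (suc n))      ≡⟨ filter-reject (λ c → ¬? (a ℕ.≟ c)) (λ a≢a → a≢a refl) ⟩
  remove a (range (suc a) n)      ≡⟨ remove-range-below a (suc a) n ℕ.≤-refl ⟩
  range (suc a) n                 ≡⟨ sym (map-punchIn-range-above a a n ℕ.≤-refl) ⟩
  map (punchIn a) (range a n)     ∎
remove-range a lo zero    lo≤a a≤hi | no a≢lo = contradiction (ℕ.≤-antisym (subst (a ≤_) (ℕ.+-identityʳ lo) a≤hi) lo≤a) a≢lo
remove-range a lo (suc n) lo≤a a≤hi | no a≢lo = begin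
  remove a (range lo (suc (suc n)))                ≡⟨ filter-accept (λ c → ¬? (a ℕ.≟ c)) a≢lo ⟩
  lo ∷ remove a (range (suc lo) (suc n))           ≡⟨ cong₂ _∷_ (cong (λ t → if t then lo else suc lo) (sym (dec-true (lo ℕ.<? a) lo<a)))
                                                               (remove-range a (suc lo) n lo<a (subst (a ≤_) (ℕ.+-suc lo n) a≤hi)) ⟩
  map (punchIn a) (range lo (suc n))               ∎
  where
  lo<a : lo < a
  lo<a = ℕ.≤∧≢⇒< lo≤a (λ lo≡a → a≢lo (sym lo≡a))

if-∧-0 : ∀ x y (v : ℤ) → (if x ∧ y then v else 0ℤ) ≡ (if x then (if y then v else 0ℤ) else 0ℤ)
if-∧-0 true  y v = refl
if-∧-0 false y v = refl

-- Ascents of permutations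

_↑_ : (ℕ → ℤ) → Bool → ℕ → ℤ
(φ ↑ t) s = φ (𝟙 t ℕ.+ s)

perms : ℕ → List (List ℕ)
perms m = filter unique? (seqs (range 1 m) m)

-- b is a virtual first letter, creating an ascent exactly when b < π₁.  Removing the first
-- letter a of a permutation and standardising the rest leaves a − 1 as the virtual letter.
ascentSum : ℕ → ℕ → (ℕ → ℤ) → ℤ
ascentSum m b φ = ∑[ π ∈ perms m ] φ (ascents (b ∷ π))

ascentSum-suc : ∀ m b φ → ascentSum (suc m) b φ ≡ ∑[ i < suc m ] ascentSum m i (φ ↑ (b <ᵇ suc i))
ascentSum-suc m b φ = begin
  ascentSum (suc m) b φ
    ≡⟨ ∑-filter unique? _ (seqs R (suc m)) ⟩
  ∑[ w ∈ seqs R (suc m) ] (if uniqueᵇ w then φ (ascents (b ∷ w)) else 0ℤ)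
    ≡⟨ ∑-seqs-suc _ R m ⟩
  ∑[ a ∈ R ] ∑[ w ∈ seqs R m ] (if fresh a w ∧ uniqueᵇ w then φ (ascents (b ∷ a ∷ w)) else 0ℤ)
    ≡⟨ ∑-range-cong 1 (suc m) firstLetter ⟩
  ∑[ a ∈ R ] ascentSum m (pred a) (φ ↑ (b <ᵇ a))
    ≡⟨ ∑-range-suc (λ a → ascentSum m (pred a) (φ ↑ (b <ᵇ a))) 0 (suc m) ⟩
  ∑[ i < suc m ] ascentSum m i (φ ↑ (b <ᵇ suc i)) ∎
  where
  R = range 1 (suc m)
  firstLetter : ∀ a → 1 ≤ a → a < 1 ℕ.+ suc m →
    ∑[ w ∈ seqs R m ] (if fresh a w ∧ uniqueᵇ w then φ (ascents (b ∷ a ∷ w)) else 0ℤ) ≡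
    ascentSum m (pred a) (φ ↑ (b <ᵇ a))
  firstLetter a@(suc a′) 1≤a a≤1+m = begin
    ∑[ w ∈ seqs R m ] (if fresh a w ∧ uniqueᵇ w then φ (ascents (b ∷ a ∷ w)) else 0ℤ)
      ≡⟨ ∑-cong (λ w → if-∧-0 (fresh a w) (uniqueᵇ w) _) (seqs R m) ⟩
    ∑[ w ∈ seqs R m ] (if fresh a w then (if uniqueᵇ w then φ (ascents (b ∷ a ∷ w)) else 0ℤ) else 0ℤ)
      ≡⟨ ∑-seqs-fresh a R m _ ⟩
    ∑[ w ∈ seqs (remove a R) m ] (if uniqueᵇ w then φ (ascents (b ∷ a ∷ w)) else 0ℤ)
      ≡⟨ cong (λ L → ∑[ w ∈ seqs L m ] (if uniqueᵇ w then φ (ascents (b ∷ a ∷ w)) else 0ℤ))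
              (remove-range a 1 m 1≤a (ℕ.≤-pred a≤1+m)) ⟩
    ∑[ w ∈ seqs (map (punchIn a) (range 1 m)) m ] (if uniqueᵇ w then φ (ascents (b ∷ a ∷ w)) else 0ℤ)
      ≡⟨ ∑-seqs-map (punchIn a) (range 1 m) m _ ⟩
    ∑[ w ∈ seqs (range 1 m) m ] (if uniqueᵇ (map (punchIn a) w) then φ (ascents (b ∷ a ∷ map (punchIn a) w)) else 0ℤ)
      ≡⟨ ∑-cong standardise (seqs (range 1 m) m) ⟩
    ∑[ w ∈ seqs (range 1 m) m ] (if uniqueᵇ w then φ (𝟙 (b <ᵇ a) ℕ.+ ascents (a′ ∷ w)) else 0ℤ)
      ≡⟨ sym (∑-filter unique? _ (seqs (range 1 m) m)) ⟩
    ascentSum m a′ (φ ↑ (b <ᵇ a)) ∎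
    where
    standardise : ∀ w → (if uniqueᵇ (map (punchIn a) w) then φ (ascents (b ∷ a ∷ map (punchIn a) w)) else 0ℤ) ≡
                        (if uniqueᵇ w then φ (𝟙 (b <ᵇ a) ℕ.+ ascents (a′ ∷ w)) else 0ℤ)
    standardise w = cong₂ (λ u s → if u then φ (𝟙 (b <ᵇ a) ℕ.+ s) else 0ℤ)
                          (uniqueᵇ-map (punchIn a) (punchIn-mono a) w)
                          (ascents-map (punchIn a) (punchIn-mono a) a a′ (punchIn-pred a′) w)

insertMax : ℕ → (ℕ → ℤ) → ℕ → ℤ
insertMax m φ s = + s * φ s + (+ suc m - + s) * φ (suc s)

insertMax-↑ : ∀ m t (φ : ℕ → ℤ) s → (insertMax (suc m) φ ↑ t) s ≡ insertMax m (φ ↑ t) s + φ (suc s)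
insertMax-↑ m true  φ s = shift (+ s) (+ m) (φ (suc s)) (φ (suc (suc s)))
  where
  shift : ∀ s m a b → (1ℤ + s) * a + (1ℤ + (1ℤ + m) - (1ℤ + s)) * b ≡ s * a + (1ℤ + m - s) * b + a
  shift = solve-∀
insertMax-↑ m false φ s = shift (+ s) (+ m) (φ s) (φ (suc s))
  where
  shift : ∀ s m a b → s * a + (1ℤ + (1ℤ + m) - s) * b ≡ s * a + (1ℤ + m - s) * b + b
  shift = solve-∀

-- Inserting the new maximum m + 1 into a slot of b π₁ ⋯ π_m keeps the number of
-- ascents exactly when the slot is an ascent; there are m + 1 slots.
ascentSum-insertMax : ∀ m b → b ≤ m → ∀ φ → ascentSum (suc m) b φ ≡ ascentSum m b (insertMax m φ)
ascentSum-insertMax zero    zero z≤n φ = cong (_+ 0ℤ) (base (φ 0) (φ 1))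
  where
  base : ∀ a b → b ≡ 0ℤ * a + (1ℤ - 0ℤ) * b
  base = solve-∀
ascentSum-insertMax (suc m) b b≤1+m φ = begin
  ascentSum (suc (suc m)) b φ
    ≡⟨ ascentSum-suc (suc m) b φ ⟩
  ∑[ i < suc (suc m) ] ascentSum (suc m) i (φ ↑ (b <ᵇ suc i))
    ≡⟨ ∑<-∷ʳ (suc m) (λ i → ascentSum (suc m) i (φ ↑ (b <ᵇ suc i))) ⟩
  ∑[ i < suc m ] ascentSum (suc m) i (φ ↑ (b <ᵇ suc i)) + ascentSum (suc m) (suc m) (φ ↑ (b <ᵇ suc (suc m)))
    ≡⟨ cong₂ _+_ (∑<-cong (suc m) (λ i i<1+m → ascentSum-insertMax m i (ℕ.≤-pred i<1+m) (φ ↑ (b <ᵇ suc i))))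
                 (cong (λ t → ascentSum (suc m) (suc m) (φ ↑ t)) (dec-true (b ℕ.<? suc (suc m)) (s≤s b≤1+m))) ⟩
  ∑[ i < suc m ] ascentSum m i (insertMax m (φ ↑ (b <ᵇ suc i))) + ascentSum (suc m) (suc m) (φ ∘ suc)
    ≡⟨ cong (_+_ (∑[ i < suc m ] ascentSum m i (insertMax m (φ ↑ (b <ᵇ suc i)))))
            (trans (ascentSum-suc m (suc m) (φ ∘ suc)) (∑<-cong (suc m) noAscent)) ⟩
  ∑[ i < suc m ] ascentSum m i (insertMax m (φ ↑ (b <ᵇ suc i))) + ∑[ i < suc m ] ascentSum m i (φ ∘ suc)
    ≡⟨ sym (∑-distrib-+ (λ i → ascentSum m i (insertMax m (φ ↑ (b <ᵇ suc i)))) (λ i → ascentSum m i (φ ∘ suc)) (range 0 (suc m))) ⟩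
  ∑[ i < suc m ] (ascentSum m i (insertMax m (φ ↑ (b <ᵇ suc i))) + ascentSum m i (φ ∘ suc))
    ≡⟨ ∑<-cong (suc m) (λ i _ → sym (trans (∑-cong (λ π → insertMax-↑ m (b <ᵇ suc i) φ (ascents (i ∷ π))) (perms m))
                                            (∑-distrib-+ (λ π → insertMax m (φ ↑ (b <ᵇ suc i)) (ascents (i ∷ π)))
                                                         (λ π → φ (suc (ascents (i ∷ π)))) (perms m)))) ⟩
  ∑[ i < suc m ] ascentSum m i (insertMax (suc m) φ ↑ (b <ᵇ suc i))
    ≡⟨ sym (ascentSum-suc m b (insertMax (suc m) φ)) ⟩
  ascentSum (suc m) b (insertMax (suc m) φ) ∎
  where
  noAscent : ∀ i → i < suc m → ascentSum m i ((φ ∘ suc) ↑ (suc m <ᵇ suc i)) ≡ ascentSum m i (φ ∘ suc)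
  noAscent i i<1+m = cong (λ t → ascentSum m i ((φ ∘ suc) ↑ t)) (dec-false (suc m ℕ.<? suc i) (ℕ.≤⇒≯ i<1+m))

-- The virtual letter m never creates an ascent.
eulerianSum : ℕ → (ℕ → ℤ) → ℤ
eulerianSum m = ascentSum m m

eulerianStep : ℕ → (ℕ → ℤ) → ℕ → ℤ
eulerianStep m φ s = + suc s * φ s + (+ m - + s) * φ (suc s)

-- The virtual letters m and m + 1 differ only in front of π₁ = m + 1.
eulerianSum-suc : ∀ m φ → eulerianSum (suc m) φ ≡ eulerianSum m (eulerianStep m φ)
eulerianSum-suc m φ = +-cancelʳ (A (φ ∘ suc)) _ _ (begin
  eulerianSum (suc m) φ + A (φ ∘ suc)          ≡⟨ cong (_+ A (φ ∘ suc)) virtual-m+1 ⟩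
  ∑[ i < m ] ascentSum m i φ + A φ + A (φ ∘ suc) ≡⟨ swap (∑[ i < m ] ascentSum m i φ) (A φ) (A (φ ∘ suc)) ⟩
  ∑[ i < m ] ascentSum m i φ + A (φ ∘ suc) + A φ ≡⟨ cong (_+ A φ) (sym virtual-m) ⟩
  ascentSum (suc m) m φ + A φ                  ≡⟨ cong (_+ A φ) (ascentSum-insertMax m m ℕ.≤-refl φ) ⟩
  A (insertMax m φ) + A φ                      ≡⟨ sym (∑-distrib-+ (insertMax m φ ∘ ascents′) (φ ∘ ascents′) (perms m)) ⟩
  ∑[ π ∈ perms m ] (insertMax m φ (ascents′ π) + φ (ascents′ π))
                                               ≡⟨ ∑-cong (λ π → rearrange (+ ascents′ π) (+ m) (φ (ascents′ π)) (φ (suc (ascents′ π)))) (perms m) ⟩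
  ∑[ π ∈ perms m ] (eulerianStep m φ (ascents′ π) + φ (suc (ascents′ π)))
                                               ≡⟨ ∑-distrib-+ (eulerianStep m φ ∘ ascents′) (φ ∘ suc ∘ ascents′) (perms m) ⟩
  A (eulerianStep m φ) + A (φ ∘ suc)           ∎)
  where
  A : (ℕ → ℤ) → ℤ
  A = ascentSum m m
  ascents′ : List ℕ → ℕ
  ascents′ π = ascents (m ∷ π)
  swap : ∀ a b c → a + b + c ≡ a + c + b
  swap = solve-∀
  rearrange : ∀ s m a b → s * a + (1ℤ + m - s) * b + a ≡ (1ℤ + s) * a + (m - s) * b + b
  rearrange = solve-∀
  virtual : ∀ b → (∀ i → i < m → (b <ᵇ suc i) ≡ false) →
            ascentSum (suc m) b φ ≡ ∑[ i < m ] ascentSum m i φ + ascentSum m m (φ ↑ (b <ᵇ suc m))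
  virtual b b≮ = trans (ascentSum-suc m b φ) (trans (∑<-∷ʳ m (λ i → ascentSum m i (φ ↑ (b <ᵇ suc i))))
    (cong (_+ ascentSum m m (φ ↑ (b <ᵇ suc m))) (∑<-cong m (λ i i<m → cong (λ t → ascentSum m i (φ ↑ t)) (b≮ i i<m)))))
  virtual-m+1 : eulerianSum (suc m) φ ≡ ∑[ i < m ] ascentSum m i φ + A φ
  virtual-m+1 = trans (virtual (suc m) (λ i i<m → dec-false (suc m ℕ.<? suc i) (ℕ.≤⇒≯ (ℕ.m≤n⇒m≤1+n i<m))))
                      (cong (λ t → ∑[ i < m ] ascentSum m i φ + A (φ ↑ t)) (dec-false (m ℕ.<? m) (ℕ.n≮n m)))
  virtual-m : ascentSum (suc m) m φ ≡ ∑[ i < m ] ascentSum m i φ + A (φ ∘ suc)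
  virtual-m = trans (virtual m (λ i i<m → dec-false (m ℕ.<? suc i) (ℕ.≤⇒≯ i<m)))
                    (cong (λ t → ∑[ i < m ] ascentSum m i φ + A (φ ↑ t)) (dec-true (m ℕ.<? suc m) ℕ.≤-refl))

eulerianSum-cong : ∀ m {φ χ : ℕ → ℤ} → (∀ s → s ≤ m → φ s ≡ χ s) → eulerianSum (suc m) φ ≡ eulerianSum (suc m) χ
eulerianSum-cong zero    φ≗χ = cong (_+ 0ℤ) (φ≗χ 0 z≤n)
eulerianSum-cong (suc m) {φ} {χ} φ≗χ = begin
  eulerianSum (suc (suc m)) φ                   ≡⟨ eulerianSum-suc (suc m) φ ⟩
  eulerianSum (suc m) (eulerianStep (suc m) φ)  ≡⟨ eulerianSum-cong m step≗ ⟩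
  eulerianSum (suc m) (eulerianStep (suc m) χ)  ≡⟨ sym (eulerianSum-suc (suc m) χ) ⟩
  eulerianSum (suc (suc m)) χ                   ∎
  where
  step≗ : ∀ s → s ≤ m → eulerianStep (suc m) φ s ≡ eulerianStep (suc m) χ s
  step≗ s s≤m = cong₂ (λ u v → + suc s * u + (+ suc m - + s) * v) (φ≗χ s (ℕ.m≤n⇒m≤1+n s≤m)) (φ≗χ (suc s) (s≤s s≤m))

E≡eulerianSum : ∀ m j → + E (suc m) j ≡ eulerianSum (suc m) (λ s → + 𝟙 (s ≡ᵇ j))
E≡eulerianSum m j = begin
  + E (suc m) j
    ≡⟨ length-filter _ (seqs [ suc m ]ₙ (suc m)) ⟩
  ∑[ w ∈ seqs [ suc m ]ₙ (suc m) ] (+ 𝟙 (uniqueᵇ w ∧ (ascents w ≡ᵇ j)))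
    ≡⟨ cong (λ L → ∑[ w ∈ seqs L (suc m) ] (+ 𝟙 (uniqueᵇ w ∧ (ascents w ≡ᵇ j)))) ([_]ₙ≡range (suc m)) ⟩
  ∑[ w ∈ seqs R (suc m) ] (+ 𝟙 (uniqueᵇ w ∧ (ascents w ≡ᵇ j)))
    ≡⟨ ∑-seqs-suc _ R m ⟩
  ∑[ a ∈ R ] ∑[ w ∈ seqs R m ] (+ 𝟙 (uniqueᵇ (a ∷ w) ∧ (ascents (a ∷ w) ≡ᵇ j)))
    ≡⟨ ∑-range-cong 1 (suc m) (λ a _ a≤1+m → ∑-cong (λ w → noVirtualAscent a w (ℕ.≤-pred a≤1+m)) (seqs R m)) ⟩
  ∑[ a ∈ R ] ∑[ w ∈ seqs R m ] (if uniqueᵇ (a ∷ w) then + 𝟙 (ascents (suc m ∷ a ∷ w) ≡ᵇ j) else 0ℤ)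
    ≡⟨ sym (∑-seqs-suc _ R m) ⟩
  ∑[ w ∈ seqs R (suc m) ] (if uniqueᵇ w then + 𝟙 (ascents (suc m ∷ w) ≡ᵇ j) else 0ℤ)
    ≡⟨ sym (∑-filter unique? _ (seqs R (suc m))) ⟩
  eulerianSum (suc m) (λ s → + 𝟙 (s ≡ᵇ j)) ∎
  where
  R = range 1 (suc m)
  noVirtualAscent : ∀ a w → a ≤ suc m →
    + 𝟙 (uniqueᵇ (a ∷ w) ∧ (ascents (a ∷ w) ≡ᵇ j)) ≡ (if uniqueᵇ (a ∷ w) then + 𝟙 (ascents (suc m ∷ a ∷ w) ≡ᵇ j) else 0ℤ)
  noVirtualAscent a w a≤1+m rewrite dec-false (suc m ℕ.<? a) (ℕ.≤⇒≯ a≤1+m) with uniqueᵇ (a ∷ w)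
  ... | true  = refl
  ... | false = refl

∑<-select : ∀ n (c : ℕ → ℤ) s → s < n → ∑[ j < n ] (c j * + 𝟙 (s ≡ᵇ j)) ≡ c s
∑<-select (suc n) c zero    _ = begin
  ∑[ j < suc n ] (c j * + 𝟙 (0 ≡ᵇ j))      ≡⟨ ∑<-suc n (λ j → c j * + 𝟙 (0 ≡ᵇ j)) ⟩
  c 0 * 1ℤ + ∑[ j < n ] (c (suc j) * 0ℤ)  ≡⟨ cong₂ _+_ (ℤ.*-identityʳ (c 0)) (trans (∑-cong (λ j → ℤ.*-zeroʳ (c (suc j))) (range 0 n)) (∑-0 (range 0 n))) ⟩
  c 0 + 0ℤ                              ≡⟨ ℤ.+-identityʳ (c 0) ⟩
  c 0                                   ∎
∑<-select (suc n) c (suc s) s<n = begin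
  ∑[ j < suc n ] (c j * + 𝟙 (suc s ≡ᵇ j))         ≡⟨ ∑<-suc n (λ j → c j * + 𝟙 (suc s ≡ᵇ j)) ⟩
  c 0 * 0ℤ + ∑[ j < n ] (c (suc j) * + 𝟙 (s ≡ᵇ j)) ≡⟨ cong₂ _+_ (ℤ.*-zeroʳ (c 0)) (∑<-select n (c ∘ suc) s (ℕ.≤-pred s<n)) ⟩
  0ℤ + c (suc s)                                  ≡⟨ ℤ.+-identityˡ (c (suc s)) ⟩
  c (suc s)                                       ∎

∑<-E : ∀ m (c : ℕ → ℤ) → ∑[ j < suc m ] (c j * + E (suc m) j) ≡ eulerianSum (suc m) c
∑<-E m c = begin
  ∑[ j < suc m ] (c j * + E (suc m) j)
    ≡⟨ ∑-cong (λ j → trans (cong (c j *_) (E≡eulerianSum m j)) (*-distribˡ-∑ (c j) _ (perms (suc m)))) (range 0 (suc m)) ⟩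
  ∑[ j < suc m ] ∑[ π ∈ perms (suc m) ] (c j * + 𝟙 (ascents (suc m ∷ π) ≡ᵇ j))
    ≡⟨ ∑-comm (λ j π → c j * + 𝟙 (ascents (suc m ∷ π) ≡ᵇ j)) (range 0 (suc m)) (perms (suc m)) ⟩
  eulerianSum (suc m) (λ s → ∑[ j < suc m ] (c j * + 𝟙 (s ≡ᵇ j)))
    ≡⟨ eulerianSum-cong m (λ s s≤m → ∑<-select (suc m) c s (s≤s s≤m)) ⟩
  eulerianSum (suc m) c ∎

-- Binomial coefficients and ordered partitions

pascal : ∀ s k → suc s C suc k ≡ s C k ℕ.+ s C suc k
pascal s k = sym (nCk+nC[k+1]≡[n+1]C[k+1] s k)

C-absorption : ∀ s k → suc k ℕ.* (s C suc k) ℕ.+ k ℕ.* (s C k) ≡ s ℕ.* (s C k)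
C-absorption zero    zero    = refl
C-absorption zero    (suc k) = cong₂ ℕ._+_ (ℕ.*-zeroʳ (suc (suc k))) (ℕ.*-zeroʳ (suc k))
C-absorption (suc s) zero    rewrite nC1≡n (suc s) = trans (ℕ.+-identityʳ _) (trans (ℕ.*-identityˡ _) (sym (ℕ.*-identityʳ _)))
C-absorption (suc s) (suc k) = begin
  suc (suc k) ℕ.* (suc s C suc (suc k)) ℕ.+ suc k ℕ.* (suc s C suc k)
    ≡⟨ cong₂ (λ a b → suc (suc k) ℕ.* a ℕ.+ suc k ℕ.* b) (pascal s (suc k)) (pascal s k) ⟩
  suc (suc k) ℕ.* (c₁ ℕ.+ c₂) ℕ.+ suc k ℕ.* (c₀ ℕ.+ c₁)
    ≡⟨ regroup k c₀ c₁ c₂ ⟩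
  (suc (suc k) ℕ.* c₂ ℕ.+ suc k ℕ.* c₁) ℕ.+ (suc k ℕ.* c₁ ℕ.+ k ℕ.* c₀) ℕ.+ (c₀ ℕ.+ c₁)
    ≡⟨ cong₂ (λ a b → a ℕ.+ b ℕ.+ (c₀ ℕ.+ c₁)) (C-absorption s (suc k)) (C-absorption s k) ⟩
  s ℕ.* c₁ ℕ.+ s ℕ.* c₀ ℕ.+ (c₀ ℕ.+ c₁)
    ≡⟨ collect s c₀ c₁ ⟩
  suc s ℕ.* (c₀ ℕ.+ c₁)
    ≡⟨ cong (suc s ℕ.*_) (sym (pascal s k)) ⟩
  suc s ℕ.* (suc s C suc k) ∎
  where
  c₀ = s C k
  c₁ = s C suc k
  c₂ = s C suc (suc k)
  regroup : ∀ k c₀ c₁ c₂ → suc (suc k) ℕ.* (c₁ ℕ.+ c₂) ℕ.+ suc k ℕ.* (c₀ ℕ.+ c₁) ≡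
            (suc (suc k) ℕ.* c₂ ℕ.+ suc k ℕ.* c₁) ℕ.+ (suc k ℕ.* c₁ ℕ.+ k ℕ.* c₀) ℕ.+ (c₀ ℕ.+ c₁)
  regroup = ℕ-solve-∀
  collect : ∀ s c₀ c₁ → s ℕ.* c₁ ℕ.+ s ℕ.* c₀ ℕ.+ (c₀ ℕ.+ c₁) ≡ suc s ℕ.* (c₀ ℕ.+ c₁)
  collect = ℕ-solve-∀

C-absorption-ℤ : ∀ s i → (1ℤ + + i) * + (s C suc i) + + i * + (s C i) ≡ + s * + (s C i)
C-absorption-ℤ s i = begin
  + suc i * + c₁ + + i * + c₀           ≡⟨ sym (cong₂ _+_ (ℤ.pos-* (suc i) c₁) (ℤ.pos-* i c₀)) ⟩
  + (suc i ℕ.* c₁ ℕ.+ i ℕ.* c₀)         ≡⟨ cong +_ (C-absorption s i) ⟩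
  + (s ℕ.* c₀)                          ≡⟨ ℤ.pos-* s c₀ ⟩
  + s * + c₀                            ∎
  where
  c₀ = s C i
  c₁ = s C suc i

-- The binomial theorem in the list-sum form used here; Algebra.Properties.Semiring.Binomial
-- states it for Fin-indexed sums.
binomial-expansion : ∀ y s N → s < N → (1ℤ + y) ^ s ≡ ∑[ i < N ] (+ (s C i) * y ^ i)
binomial-expansion y zero (suc N) _ = sym (begin
  ∑[ i < suc N ] (+ (0 C i) * y ^ i)          ≡⟨ ∑<-suc N (λ i → + (0 C i) * y ^ i) ⟩
  1ℤ * 1ℤ + ∑[ i < N ] (0ℤ * y ^ suc i)       ≡⟨ cong (_+_ 1ℤ) (trans (∑-cong (λ i → ℤ.*-zeroˡ (y ^ suc i)) (range 0 N)) (∑-0 (range 0 N))) ⟩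
  1ℤ + 0ℤ                                     ∎)
binomial-expansion y (suc s) (suc N) (s≤s s<N) = begin
  (1ℤ + y) * (1ℤ + y) ^ s   ≡⟨ cong ((1ℤ + y) *_) (binomial-expansion y s (suc N) (ℕ.m<n⇒m<1+n s<N)) ⟩
  (1ℤ + y) * A              ≡⟨ ℤ.*-distribʳ-+ A 1ℤ y ⟩
  1ℤ * A + y * A            ≡⟨ cong₂ _+_ (trans (ℤ.*-identityˡ A) (∑<-suc N (λ i → + (s C i) * y ^ i))) y*A ⟩
  (1ℤ + Q) + (P + 0ℤ)       ≡⟨ regroup P Q ⟩
  1ℤ + (P + Q)              ≡⟨ cong (_+_ 1ℤ) (sym P+Q) ⟩
  1ℤ + ∑[ i < N ] (+ (suc s C suc i) * y ^ suc i)
                            ≡⟨ sym (∑<-suc N (λ i → + (suc s C i) * y ^ i)) ⟩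
  ∑[ i < suc N ] (+ (suc s C i) * y ^ i) ∎
  where
  A = ∑[ i < suc N ] (+ (s C i) * y ^ i)
  P = ∑[ i < N ] (+ (s C i) * y ^ suc i)
  Q = ∑[ i < N ] (+ (s C suc i) * y ^ suc i)
  regroup : ∀ P Q → (1ℤ + Q) + (P + 0ℤ) ≡ 1ℤ + (P + Q)
  regroup = solve-∀
  swap : ∀ y c z → y * (c * z) ≡ c * (y * z)
  swap = solve-∀
  P+Q : ∑[ i < N ] (+ (suc s C suc i) * y ^ suc i) ≡ P + Q
  P+Q = trans (∑-cong (λ i → trans (cong (λ c → + c * y ^ suc i) (pascal s i)) (ℤ.*-distribʳ-+ (y ^ suc i) (+ (s C i)) (+ (s C suc i))))
                      (range 0 N))
              (∑-distrib-+ (λ i → + (s C i) * y ^ suc i) (λ i → + (s C suc i) * y ^ suc i) (range 0 N))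
  y*A : y * A ≡ P + 0ℤ
  y*A = begin
    y * A                                          ≡⟨ *-distribˡ-∑ y _ (range 0 (suc N)) ⟩
    ∑[ i < suc N ] (y * (+ (s C i) * y ^ i))        ≡⟨ ∑-cong (λ i → swap y (+ (s C i)) (y ^ i)) (range 0 (suc N)) ⟩
    ∑[ i < suc N ] (+ (s C i) * y ^ suc i)          ≡⟨ ∑<-∷ʳ N (λ i → + (s C i) * y ^ suc i) ⟩
    P + + (s C N) * y ^ suc N                      ≡⟨ cong (λ c → P + + c * y ^ suc N) (k>n⇒nCk≡0 s<N) ⟩
    P + 0ℤ * y ^ suc N                             ≡⟨ cong (_+_ P) (ℤ.*-zeroˡ (y ^ suc N)) ⟩
    P + 0ℤ                                         ∎

-- O m ℓ is the number of ordered partitions of [m] into ℓ blocks: the element m + 1 either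
-- joins one of ℓ + 1 blocks or forms a new block at one of ℓ + 1 positions.
O : ℕ → ℕ → ℤ
O zero    zero    = 1ℤ
O zero    (suc ℓ) = 0ℤ
O (suc m) zero    = 0ℤ
O (suc m) (suc ℓ) = + suc ℓ * (O m (suc ℓ) + O m ℓ)

O-vanish : ∀ m ℓ → m < ℓ → O m ℓ ≡ 0ℤ
O-vanish zero    (suc ℓ) _         = refl
O-vanish (suc m) (suc ℓ) (s≤s m<ℓ) = begin
  + suc ℓ * (O m (suc ℓ) + O m ℓ) ≡⟨ cong₂ (λ a b → + suc ℓ * (a + b)) (O-vanish m (suc ℓ) (ℕ.m<n⇒m<1+n m<ℓ)) (O-vanish m ℓ m<ℓ) ⟩
  + suc ℓ * 0ℤ                    ≡⟨ ℤ.*-zeroʳ (+ suc ℓ) ⟩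
  0ℤ                              ∎

eulerianStep-C : ∀ {m i ℓ} → suc i ℕ.+ ℓ ≡ m → ∀ s →
                 eulerianStep m (λ s → + (s C suc i)) s ≡ + suc ℓ * (+ (s C i) + + (s C suc i))
eulerianStep-C {i = i} {ℓ} refl s =
  trans (cong (λ c → + suc s * + (s C suc i) + (+ (suc i ℕ.+ ℓ) - + s) * + c) (pascal s i))
        (combine (+ s) (+ i) (+ ℓ) (+ (s C i)) (+ (s C suc i)) (C-absorption-ℤ s i))
  where
  combine : ∀ s i ℓ c₀ c₁ → (1ℤ + i) * c₁ + i * c₀ ≡ s * c₀ →
            (1ℤ + s) * c₁ + (1ℤ + i + ℓ - s) * (c₀ + c₁) ≡ (1ℤ + ℓ) * (c₀ + c₁)
  combine s i ℓ c₀ c₁ absorb = trans (expand s i ℓ c₀ c₁) (trans (cong (λ u → u - s * c₀ + (1ℤ + ℓ) * (c₀ + c₁)) absorb)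
                                                                 (cancel (s * c₀) ((1ℤ + ℓ) * (c₀ + c₁))))
    where
    expand : ∀ s i ℓ c₀ c₁ → (1ℤ + s) * c₁ + (1ℤ + i + ℓ - s) * (c₀ + c₁) ≡
                             (1ℤ + i) * c₁ + i * c₀ - s * c₀ + (1ℤ + ℓ) * (c₀ + c₁)
    expand = solve-∀
    cancel : ∀ a b → a - a + b ≡ b
    cancel = solve-∀

eulerianSum-C≡O : ∀ m i ℓ → i ℕ.+ ℓ ≡ m → eulerianSum m (λ s → + (s C i)) ≡ O m ℓ
eulerianSum-C≡O zero    zero    zero    _ = refl
eulerianSum-C≡O (suc m) i       zero    i+0≡1+m = begin
  eulerianSum (suc m) (λ s → + (s C i)) ≡⟨ eulerianSum-cong m (λ s s≤m → cong +_ (k>n⇒nCk≡0 (ℕ.<-≤-trans (s≤s s≤m) (ℕ.≤-reflexive i≡1+m)))) ⟩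
  eulerianSum (suc m) (λ _ → 0ℤ)        ≡⟨ ∑-0 (perms (suc m)) ⟩
  0ℤ                                    ∎
  where
  i≡1+m : suc m ≡ i
  i≡1+m = sym (trans (sym (ℕ.+-identityʳ i)) i+0≡1+m)
eulerianSum-C≡O (suc m) zero    (suc ℓ) refl = begin
  eulerianSum (suc m) (λ _ → 1ℤ)                ≡⟨ eulerianSum-suc m (λ _ → 1ℤ) ⟩
  eulerianSum m (eulerianStep m (λ _ → 1ℤ))      ≡⟨ ∑-cong (λ π → total (+ ascents (m ∷ π)) (+ m)) (perms m) ⟩
  eulerianSum m (λ _ → + suc m * 1ℤ)            ≡⟨ sym (*-distribˡ-∑ (+ suc m) (λ _ → 1ℤ) (perms m)) ⟩
  + suc m * eulerianSum m (λ s → + (s C 0))     ≡⟨ cong (+ suc m *_) (eulerianSum-C≡O m 0 m refl) ⟩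
  + suc m * O m m                               ≡⟨ cong (+ suc m *_) (sym (ℤ.+-identityˡ (O m m))) ⟩
  + suc m * (0ℤ + O m m)                        ≡⟨ cong (λ o → + suc m * (o + O m m)) (sym (O-vanish m (suc m) ℕ.≤-refl)) ⟩
  O (suc m) (suc m)                             ∎
  where
  total : ∀ s m → (1ℤ + s) * 1ℤ + (m - s) * 1ℤ ≡ (1ℤ + m) * 1ℤ
  total = solve-∀
eulerianSum-C≡O (suc m) (suc i) (suc ℓ) 1+i+1+ℓ≡1+m = begin
  eulerianSum (suc m) (λ s → + (s C suc i))                      ≡⟨ eulerianSum-suc m (λ s → + (s C suc i)) ⟩
  eulerianSum m (eulerianStep m (λ s → + (s C suc i)))            ≡⟨ ∑-cong (λ π → eulerianStep-C m≡ (ascents (m ∷ π))) (perms m) ⟩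
  eulerianSum m (λ s → + suc ℓ * (+ (s C i) + + (s C suc i)))    ≡⟨ sym (*-distribˡ-∑ (+ suc ℓ) _ (perms m)) ⟩
  + suc ℓ * eulerianSum m (λ s → + (s C i) + + (s C suc i))      ≡⟨ cong (+ suc ℓ *_) (∑-distrib-+ _ _ (perms m)) ⟩
  + suc ℓ * (eulerianSum m (λ s → + (s C i)) + eulerianSum m (λ s → + (s C suc i)))
                      ≡⟨ cong₂ (λ a b → + suc ℓ * (a + b)) (eulerianSum-C≡O m i (suc ℓ) (trans (ℕ.+-suc i ℓ) m≡)) (eulerianSum-C≡O m (suc i) ℓ m≡) ⟩
  O (suc m) (suc ℓ)                                              ∎
  where
  m≡ : suc i ℕ.+ ℓ ≡ m
  m≡ = ℕ.suc-injective (trans (sym (ℕ.+-suc (suc i) ℓ)) 1+i+1+ℓ≡1+m)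

-- Words covering a set of letters

≡ᵇ-reflects-≡ : ∀ m n → Reflects (m ≡ n) (m ≡ᵇ n)
≡ᵇ-reflects-≡ m n = proof (m ℕ.≟ n)

_∈ᵇ_ : ℕ → List ℕ → Bool
a ∈ᵇ T = does (a ∈? T)

∈ᵇ-reflects-∈ : ∀ a T → Reflects (a ∈ T) (a ∈ᵇ T)
∈ᵇ-reflects-∈ a T = proof (a ∈? T)

coversᵇ : List ℕ → List ℕ → Bool
coversᵇ T w = does (all? (_∈? w) T)

coversᵇ-∷ : ∀ a T w → coversᵇ T (a ∷ w) ≡ coversᵇ (remove a T) w
coversᵇ-∷ a []      w = refl
coversᵇ-∷ a (t ∷ T) w with a ≡ᵇ t | ≡ᵇ-reflects-≡ a t
... | true  | ofʸ refl = trans (cong (λ b → (b ∨ a ∈ᵇ w) ∧ coversᵇ T (a ∷ w)) (dec-true (a ℕ.≟ a) refl)) (coversᵇ-∷ a T w)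
... | false | ofⁿ a≢t  = cong₂ (λ b c → (b ∨ t ∈ᵇ w) ∧ c) (dec-false (t ℕ.≟ a) (a≢t ∘ sym)) (coversᵇ-∷ a T w)

remove-∉ : ∀ {a T} → a ∉ T → remove a T ≡ T
remove-∉ {a} {T} a∉T = filter-all (λ c → ¬? (a ℕ.≟ c)) (¬Any⇒All¬ T a∉T)

length-remove-∈ : ∀ {a T} → Unique T → a ∈ T → suc (length (remove a T)) ≡ length T
length-remove-∈ {a} {a ∷ T} (a∉T ∷ _)  (here refl) = begin
  suc (length (remove a (a ∷ T))) ≡⟨ cong (suc ∘ length) (filter-reject (λ c → ¬? (a ℕ.≟ c)) (λ a≢a → a≢a refl)) ⟩
  suc (length (remove a T))       ≡⟨ cong (suc ∘ length) (remove-∉ (All¬⇒¬Any a∉T)) ⟩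
  suc (length T)                  ∎
length-remove-∈ {a} {t ∷ T} (t∉T ∷ uT) (there a∈T) = begin
  suc (length (remove a (t ∷ T))) ≡⟨ cong (suc ∘ length) (filter-accept (λ c → ¬? (a ℕ.≟ c)) (λ a≡t → All.lookup t∉T a∈T (sym a≡t))) ⟩
  suc (suc (length (remove a T))) ≡⟨ cong suc (length-remove-∈ uT a∈T) ⟩
  suc (length T)                  ∎

∑-≡ᵇ-∉ : ∀ t A → t ∉ A → ∑[ a ∈ A ] (+ 𝟙 (a ≡ᵇ t)) ≡ 0ℤ
∑-≡ᵇ-∉ t []      t∉A = refl
∑-≡ᵇ-∉ t (a ∷ A) t∉A = trans (cong₂ _+_ (cong (+_ ∘ 𝟙) (dec-false (a ℕ.≟ t) (λ a≡t → t∉A (here (sym a≡t)))))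
                                         (∑-≡ᵇ-∉ t A (t∉A ∘ there)))
                             (ℤ.+-identityˡ 0ℤ)

∑-≡ᵇ-∈ : ∀ {t A} → Unique A → t ∈ A → ∑[ a ∈ A ] (+ 𝟙 (a ≡ᵇ t)) ≡ 1ℤ
∑-≡ᵇ-∈ {t} {t ∷ A} (t∉A ∷ _) (here refl) =
  cong₂ _+_ (cong (+_ ∘ 𝟙) (dec-true (t ℕ.≟ t) refl)) (∑-≡ᵇ-∉ t A (All¬⇒¬Any t∉A))
∑-≡ᵇ-∈ {t} {a ∷ A} (a∉A ∷ uA) (there t∈A) =
  trans (cong₂ _+_ (cong (+_ ∘ 𝟙) (dec-false (a ℕ.≟ t) (λ a≡t → All.lookup a∉A t∈A a≡t))) (∑-≡ᵇ-∈ uA t∈A))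
        (ℤ.+-identityˡ 1ℤ)

∑-∈ᵇ : ∀ {A T} → Unique A → Unique T → T ⊆ A → ∑[ a ∈ A ] (+ 𝟙 (a ∈ᵇ T)) ≡ + length T
∑-∈ᵇ {A} {[]}    uA uT T⊆A = ∑-0 A
∑-∈ᵇ {A} {t ∷ T} uA (t∉T ∷ uT) T⊆A = begin
  ∑[ a ∈ A ] (+ 𝟙 (a ∈ᵇ (t ∷ T)))                         ≡⟨ ∑-cong split A ⟩
  ∑[ a ∈ A ] (+ 𝟙 (a ≡ᵇ t) + + 𝟙 (a ∈ᵇ T))                ≡⟨ ∑-distrib-+ (λ a → + 𝟙 (a ≡ᵇ t)) (λ a → + 𝟙 (a ∈ᵇ T)) A ⟩
  ∑[ a ∈ A ] (+ 𝟙 (a ≡ᵇ t)) + ∑[ a ∈ A ] (+ 𝟙 (a ∈ᵇ T))   ≡⟨ cong₂ _+_ (∑-≡ᵇ-∈ uA (T⊆A (here refl))) (∑-∈ᵇ uA uT (T⊆A ∘ there)) ⟩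
  + suc (length T)                                        ∎
  where
  split : ∀ a → + 𝟙 (a ∈ᵇ (t ∷ T)) ≡ + 𝟙 (a ≡ᵇ t) + + 𝟙 (a ∈ᵇ T)
  split a with a ≡ᵇ t | ≡ᵇ-reflects-≡ a t
  ... | true  | ofʸ refl = cong (λ b → 1ℤ + + 𝟙 b) (sym (dec-false (a ∈? T) (All¬⇒¬Any t∉T)))
  ... | false | _        = refl

∑-remove : ∀ (F : ℕ → ℤ) {A T} → Unique A → Unique T → T ⊆ A →
           ∑[ a ∈ A ] F (length (remove a T)) ≡ + length T * F (pred (length T)) + (+ length A - + length T) * F (length T)
∑-remove F {A} {T} uA uT T⊆A = begin
  ∑[ a ∈ A ] F (length (remove a T))
    ≡⟨ ∑-cong byMembership A ⟩
  ∑[ a ∈ A ] (if a ∈ᵇ T then F (pred (length T)) else F (length T))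
    ≡⟨ ∑-if (_∈ᵇ T) _ _ A ⟩
  ∑[ a ∈ A ] (+ 𝟙 (a ∈ᵇ T)) * F (pred (length T)) + (+ length A - ∑[ a ∈ A ] (+ 𝟙 (a ∈ᵇ T))) * F (length T)
    ≡⟨ cong (λ c → c * F (pred (length T)) + (+ length A - c) * F (length T)) (∑-∈ᵇ uA uT T⊆A) ⟩
  + length T * F (pred (length T)) + (+ length A - + length T) * F (length T) ∎
  where
  byMembership : ∀ a → F (length (remove a T)) ≡ (if a ∈ᵇ T then F (pred (length T)) else F (length T))
  byMembership a with a ∈ᵇ T | ∈ᵇ-reflects-∈ a T
  ... | true  | ofʸ a∈T = cong (F ∘ pred) (length-remove-∈ uT a∈T)
  ... | false | ofⁿ a∉T = cong (F ∘ length) (remove-∉ a∉T)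

-- Σ φ(number of 1s) over the words of length k over {1} ∪ A that use every letter of T, where
-- |A| = p and T ⊆ A has q elements (∑-covering): the first letter is 1, one of the q letters
-- of T, or one of the other p − q letters of A.
coverSum : ℕ → ℕ → ℕ → (ℕ → ℤ) → ℤ
coverSum p zero    zero    φ = φ 0
coverSum p zero    (suc q) φ = 0ℤ
coverSum p (suc k) q       φ = coverSum p k q (φ ∘ suc) + (+ q * coverSum p k (pred q) φ + (+ p - + q) * coverSum p k q φ)

1∉⇒blockSize-∷ : ∀ {a A} w → 1 ∉ A → a ∈ A → blockSize 1 (a ∷ w) ≡ blockSize 1 w
1∉⇒blockSize-∷ {a} w 1∉A a∈A = cong length (filter-reject (ℕ._≟ 1) {a} {w} (λ { refl → 1∉A a∈A }))

∑-covering : ∀ {A} → 1 ∉ A → Unique A → ∀ k {T} φ → Unique T → T ⊆ A →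
             ∑[ w ∈ seqs (1 ∷ A) k ] (if coversᵇ T w then φ (blockSize 1 w) else 0ℤ) ≡ coverSum (length A) k (length T) φ
∑-covering 1∉A uA zero    {[]}    φ uT T⊆A = ℤ.+-identityʳ (φ 0)
∑-covering 1∉A uA zero    {t ∷ T} φ uT T⊆A = refl
∑-covering {A} 1∉A uA (suc k) {T} φ uT T⊆A = begin
  ∑[ w ∈ seqs (1 ∷ A) (suc k) ] (if coversᵇ T w then φ (blockSize 1 w) else 0ℤ)
    ≡⟨ ∑-seqs-suc _ (1 ∷ A) k ⟩
  ∑[ w ∈ seqs (1 ∷ A) k ] (if coversᵇ T (1 ∷ w) then φ (suc (blockSize 1 w)) else 0ℤ) +
  ∑[ a ∈ A ] ∑[ w ∈ seqs (1 ∷ A) k ] (if coversᵇ T (a ∷ w) then φ (blockSize 1 (a ∷ w)) else 0ℤ)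
    ≡⟨ cong₂ _+_ (trans (∑-cong (λ w → cong (λ b → if b then φ (suc (blockSize 1 w)) else 0ℤ) (coversᵇ-1∷ w)) (seqs (1 ∷ A) k))
                        (∑-covering 1∉A uA k (φ ∘ suc) uT T⊆A))
                 (∑-cong-∈ A otherLetter) ⟩
  coverSum p k q (φ ∘ suc) + ∑[ a ∈ A ] coverSum p k (length (remove a T)) φ
    ≡⟨ cong (_+_ (coverSum p k q (φ ∘ suc))) (∑-remove (λ l → coverSum p k l φ) uA uT T⊆A) ⟩
  coverSum p k q (φ ∘ suc) + (+ q * coverSum p k (pred q) φ + (+ p - + q) * coverSum p k q φ) ∎
  where
  p = length A
  q = length T
  coversᵇ-1∷ : ∀ w → coversᵇ T (1 ∷ w) ≡ coversᵇ T w
  coversᵇ-1∷ w = trans (coversᵇ-∷ 1 T w) (cong (λ L → coversᵇ L w) (remove-∉ (1∉A ∘ T⊆A)))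
  otherLetter : ∀ a → a ∈ A →
    ∑[ w ∈ seqs (1 ∷ A) k ] (if coversᵇ T (a ∷ w) then φ (blockSize 1 (a ∷ w)) else 0ℤ) ≡ coverSum p k (length (remove a T)) φ
  otherLetter a a∈A = begin
    ∑[ w ∈ seqs (1 ∷ A) k ] (if coversᵇ T (a ∷ w) then φ (blockSize 1 (a ∷ w)) else 0ℤ)
      ≡⟨ ∑-cong (λ w → cong₂ (λ b s → if b then φ s else 0ℤ) (coversᵇ-∷ a T w) (1∉⇒blockSize-∷ w 1∉A a∈A)) (seqs (1 ∷ A) k) ⟩
    ∑[ w ∈ seqs (1 ∷ A) k ] (if coversᵇ (remove a T) w then φ (blockSize 1 w) else 0ℤ)
      ≡⟨ ∑-covering 1∉A uA k φ (Unique.filter⁺ (λ c → ¬? (a ℕ.≟ c)) uT) (⊆-trans (filter-⊆ (λ c → ¬? (a ℕ.≟ c)) T) T⊆A) ⟩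
    coverSum p k (length (remove a T)) φ ∎

-- The number of words of length k over p letters that use each of q given letters.
covering : ℕ → ℕ → ℕ → ℤ
covering p zero    zero    = 1ℤ
covering p zero    (suc q) = 0ℤ
covering p (suc k) q       = + q * covering p k (pred q) + (+ p - + q) * covering p k q

coverSum-cong : ∀ p k q {φ χ : ℕ → ℤ} → (∀ s → φ s ≡ χ s) → coverSum p k q φ ≡ coverSum p k q χ
coverSum-cong p zero    zero    φ≗χ = φ≗χ 0
coverSum-cong p zero    (suc q) φ≗χ = refl
coverSum-cong p (suc k) q       φ≗χ = cong₂ _+_ (coverSum-cong p k q (φ≗χ ∘ suc))
  (cong₂ (λ u v → + q * u + (+ p - + q) * v) (coverSum-cong p k (pred q) φ≗χ) (coverSum-cong p k q φ≗χ))

coverSum-+ : ∀ p k q (φ χ : ℕ → ℤ) → coverSum p k q (λ s → φ s + χ s) ≡ coverSum p k q φ + coverSum p k q χ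
coverSum-+ p zero    zero    φ χ = refl
coverSum-+ p zero    (suc q) φ χ = refl
coverSum-+ p (suc k) q       φ χ = trans
  (cong₂ _+_ (coverSum-+ p k q (φ ∘ suc) (χ ∘ suc))
             (cong₂ (λ u v → + q * u + (+ p - + q) * v) (coverSum-+ p k (pred q) φ χ) (coverSum-+ p k q φ χ)))
  (regroup (+ q) (+ p - + q) (coverSum p k q (φ ∘ suc)) (coverSum p k q (χ ∘ suc))
           (coverSum p k (pred q) φ) (coverSum p k (pred q) χ) (coverSum p k q φ) (coverSum p k q χ))
  where
  regroup : ∀ q d a₁ a₂ b₁ b₂ c₁ c₂ → a₁ + a₂ + (q * (b₁ + b₂) + d * (c₁ + c₂)) ≡
                                      a₁ + (q * b₁ + d * c₁) + (a₂ + (q * b₂ + d * c₂))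
  regroup = solve-∀

coverSum-0 : ∀ p k q → coverSum p k q (λ _ → 0ℤ) ≡ 0ℤ
coverSum-0 p zero    zero    = refl
coverSum-0 p zero    (suc q) = refl
coverSum-0 p (suc k) q       = trans
  (cong₂ _+_ (coverSum-0 p k q) (cong₂ (λ u v → + q * u + (+ p - + q) * v) (coverSum-0 p k (pred q)) (coverSum-0 p k q)))
  (vanish (+ q) (+ p - + q))
  where
  vanish : ∀ q d → 0ℤ + (q * 0ℤ + d * 0ℤ) ≡ 0ℤ
  vanish = solve-∀

coverSum-[=0] : ∀ p k q → coverSum p k q (λ s → + 𝟙 (s ≡ᵇ 0)) ≡ covering p k q
coverSum-[=0] p zero    zero    = refl
coverSum-[=0] p zero    (suc q) = refl
coverSum-[=0] p (suc k) q       = trans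
  (cong₂ _+_ (coverSum-0 p k q) (cong₂ (λ u v → + q * u + (+ p - + q) * v) (coverSum-[=0] p k (pred q)) (coverSum-[=0] p k q)))
  (ℤ.+-identityˡ _)

coverSum-1 : ∀ p k q → coverSum p k q (λ _ → 1ℤ) ≡ covering (suc p) k q
coverSum-1 p zero    zero    = refl
coverSum-1 p zero    (suc q) = refl
coverSum-1 p (suc k) q       = trans
  (cong₂ _+_ (coverSum-1 p k q) (cong₂ (λ u v → + q * u + (+ p - + q) * v) (coverSum-1 p k (pred q)) (coverSum-1 p k q)))
  (collect (+ q) (+ p) (covering (suc p) k (pred q)) (covering (suc p) k q))
  where
  collect : ∀ q p a b → b + (q * a + (p - q) * b) ≡ q * a + (1ℤ + p - q) * b
  collect = solve-∀

coverSum-[>0] : ∀ p k q → coverSum p k q (λ s → + 𝟙 (0 <ᵇ s)) ≡ covering (suc p) k (suc q)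
coverSum-[>0] p zero    zero    = refl
coverSum-[>0] p zero    (suc q) = refl
coverSum-[>0] p (suc k) q       = trans
  (cong₂ _+_ (coverSum-1 p k q) (cong₂ (λ u v → + q * u + (+ p - + q) * v) (coverSum-[>0] p k (pred q)) (coverSum-[>0] p k q)))
  (trans (cong (λ u → covering (suc p) k q + (u + (+ p - + q) * covering (suc p) k (suc q))) (q*suc-pred q))
         (collect (+ q) (+ p) (covering (suc p) k q) (covering (suc p) k (suc q))))
  where
  q*suc-pred : ∀ q → + q * covering (suc p) k (suc (pred q)) ≡ + q * covering (suc p) k q
  q*suc-pred zero    = trans (ℤ.*-zeroˡ (covering (suc p) k 1)) (sym (ℤ.*-zeroˡ (covering (suc p) k 0)))
  q*suc-pred (suc q) = refl
  collect : ∀ q p a b → a + (q * a + (p - q) * b) ≡ (1ℤ + q) * a + (1ℤ + p - (1ℤ + q)) * b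
  collect = solve-∀

coverSum-[=1] : ∀ p k q → coverSum p k q (λ s → + 𝟙 (s ≡ᵇ 1)) ≡ + k * covering p (pred k) q
coverSum-[=1] p zero    zero    = refl
coverSum-[=1] p zero    (suc q) = refl
coverSum-[=1] p (suc k) q       = trans
  (cong₂ _+_ (coverSum-[=0] p k q) (cong₂ (λ u v → + q * u + (+ p - + q) * v) (coverSum-[=1] p k (pred q)) (coverSum-[=1] p k q)))
  (collect k)
  where
  collect : ∀ k → covering p k q + (+ q * (+ k * covering p (pred k) (pred q)) + (+ p - + q) * (+ k * covering p (pred k) q)) ≡
                  + suc k * covering p k q
  collect zero    = base (+ q) (+ p) (covering p 0 q) (covering p 0 (pred q))
    where
    base : ∀ q p c c′ → c + (q * (0ℤ * c′) + (p - q) * (0ℤ * c)) ≡ 1ℤ * c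
    base = solve-∀
  collect (suc k) = factor (+ q) (+ p) (+ suc k) (covering p k (pred q)) (covering p k q)
    where
    factor : ∀ q p k a b → q * a + (p - q) * b + (q * (k * a) + (p - q) * (k * b)) ≡ (1ℤ + k) * (q * a + (p - q) * b)
    factor = solve-∀

-- Pascal's rule for the alphabet: split by whether the extra letter is used.
covering-suc : ∀ p k q → covering (suc p) k q ≡ covering (suc p) k (suc q) + covering p k q
covering-suc p zero    zero    = refl
covering-suc p zero    (suc q) = refl
covering-suc p (suc k) zero    = step (+ p) (covering (suc p) k 0) (covering (suc p) k 1) (covering p k 0) (covering-suc p k 0)
  where
  step′ : ∀ p c d → 0ℤ * (c + d) + (1ℤ + p - 0ℤ) * (c + d) ≡ 1ℤ * (c + d) + (1ℤ + p - 1ℤ) * c + (0ℤ * d + (p - 0ℤ) * d)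
  step′ = solve-∀
  step : ∀ p a c d → a ≡ c + d → 0ℤ * a + (1ℤ + p - 0ℤ) * a ≡ 1ℤ * a + (1ℤ + p - 1ℤ) * c + (0ℤ * d + (p - 0ℤ) * d)
  step p .(c + d) c d refl = step′ p c d
covering-suc p (suc k) (suc q) =
  step (+ q) (+ p) (covering (suc p) k q) (covering (suc p) k (suc q)) (covering p k q)
       (covering (suc p) k (suc (suc q))) (covering p k (suc q)) (covering-suc p k q) (covering-suc p k (suc q))
  where
  step′ : ∀ q p b c d → (1ℤ + q) * (c + d + b) + (1ℤ + p - (1ℤ + q)) * (c + d) ≡
          (1ℤ + (1ℤ + q)) * (c + d) + (1ℤ + p - (1ℤ + (1ℤ + q))) * c + ((1ℤ + q) * b + (p - (1ℤ + q)) * d)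
  step′ = solve-∀
  step : ∀ q p x a b c d → x ≡ a + b → a ≡ c + d → (1ℤ + q) * x + (1ℤ + p - (1ℤ + q)) * a ≡
         (1ℤ + (1ℤ + q)) * a + (1ℤ + p - (1ℤ + (1ℤ + q))) * c + ((1ℤ + q) * b + (p - (1ℤ + q)) * d)
  step q p .(c + d + b) .(c + d) b c d refl refl = step′ q p b c d

covering≡O : ∀ k ℓ → covering ℓ k ℓ ≡ O k ℓ
covering≡O zero    zero    = refl
covering≡O zero    (suc ℓ) = refl
covering≡O (suc k) zero    = vanish (covering 0 k 0)
  where
  vanish : ∀ a → 0ℤ * a + (0ℤ - 0ℤ) * a ≡ 0ℤ
  vanish = solve-∀
covering≡O (suc k) (suc ℓ) = begin
  + suc ℓ * covering (suc ℓ) k ℓ + (+ suc ℓ - + suc ℓ) * covering (suc ℓ) k (suc ℓ)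
    ≡⟨ cong (λ c → + suc ℓ * c + (+ suc ℓ - + suc ℓ) * covering (suc ℓ) k (suc ℓ))
            (trans (covering-suc ℓ k ℓ) (cong₂ _+_ (covering≡O k (suc ℓ)) (covering≡O k ℓ))) ⟩
  + suc ℓ * (O k (suc ℓ) + O k ℓ) + (+ suc ℓ - + suc ℓ) * covering (suc ℓ) k (suc ℓ)
    ≡⟨ vanish (+ suc ℓ) (O k (suc ℓ) + O k ℓ) (covering (suc ℓ) k (suc ℓ)) ⟩
  O (suc k) (suc ℓ) ∎
  where
  vanish : ∀ l a b → l * a + (l - l) * b ≡ l * a
  vanish = solve-∀

blockSize-∈ᵇ : ∀ f → 1 ∈ᵇ f ≡ (0 <ᵇ blockSize 1 f)
blockSize-∈ᵇ []                = refl
blockSize-∈ᵇ (zero ∷ f)        = blockSize-∈ᵇ f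
blockSize-∈ᵇ (suc zero ∷ f)    = refl
blockSize-∈ᵇ (suc (suc a) ∷ f) = blockSize-∈ᵇ f

O₂≡coverSum : ∀ n p → + O₂ n (suc p) ≡ coverSum p n p (λ s → + 𝟙 (1 <ᵇ s))
O₂≡coverSum n p = begin
  + O₂ n (suc p)
    ≡⟨ length-filter _ (seqs [ suc p ]ₙ n) ⟩
  ∑[ f ∈ seqs [ suc p ]ₙ n ] (+ 𝟙 (coversᵇ [ suc p ]ₙ f ∧ (1 <ᵇ blockSize 1 f)))
    ≡⟨ cong (λ L → ∑[ f ∈ seqs L n ] (+ 𝟙 (coversᵇ L f ∧ (1 <ᵇ blockSize 1 f)))) ([_]ₙ≡range (suc p)) ⟩
  ∑[ f ∈ seqs (1 ∷ A) n ] (+ 𝟙 ((1 ∈ᵇ f ∧ coversᵇ A f) ∧ (1 <ᵇ blockSize 1 f)))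
    ≡⟨ ∑-cong (λ f → trans (cong (λ b → + 𝟙 ((b ∧ coversᵇ A f) ∧ (1 <ᵇ blockSize 1 f))) (blockSize-∈ᵇ f))
                           (atLeastTwo (blockSize 1 f) (coversᵇ A f))) (seqs (1 ∷ A) n) ⟩
  ∑[ f ∈ seqs (1 ∷ A) n ] (if coversᵇ A f then + 𝟙 (1 <ᵇ blockSize 1 f) else 0ℤ)
    ≡⟨ ∑-covering (range-< 2 p (s≤s (s≤s z≤n))) (Unique-range 2 p) n _ (Unique-range 2 p) (λ a∈A → a∈A) ⟩
  coverSum (length A) n (length A) (λ s → + 𝟙 (1 <ᵇ s))
    ≡⟨ cong (λ l → coverSum l n l (λ s → + 𝟙 (1 <ᵇ s))) (length-range 2 p) ⟩
  coverSum p n p (λ s → + 𝟙 (1 <ᵇ s)) ∎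
  where
  A = range 2 p
  atLeastTwo : ∀ s c → + 𝟙 (((0 <ᵇ s) ∧ c) ∧ (1 <ᵇ s)) ≡ (if c then + 𝟙 (1 <ᵇ s) else 0ℤ)
  atLeastTwo zero    true  = refl
  atLeastTwo zero    false = refl
  atLeastTwo (suc s) true  = refl
  atLeastTwo (suc s) false = refl

O₂-formula : ∀ m p → + O₂ (suc m) (suc p) ≡ O (suc m) (suc p) - + suc m * O m p
O₂-formula m p = begin
  + O₂ (suc m) (suc p)                                    ≡⟨ O₂≡coverSum (suc m) p ⟩
  coverSum p (suc m) p (λ s → + 𝟙 (1 <ᵇ s))               ≡⟨ subtract _ _ _ atLeastOne ⟩
  coverSum p (suc m) p (λ s → + 𝟙 (0 <ᵇ s)) - + suc m * covering p m p
    ≡⟨ cong₂ (λ a b → a - + suc m * b) (trans (coverSum-[>0] p (suc m) p) (covering≡O (suc m) (suc p))) (covering≡O m p) ⟩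
  O (suc m) (suc p) - + suc m * O m p                     ∎
  where
  subtract : ∀ a b c → a ≡ b + c → b ≡ a - c
  subtract .(b + c) b c refl = cancel b c
    where
    cancel : ∀ b c → b ≡ b + c - c
    cancel = solve-∀
  atLeastOne : coverSum p (suc m) p (λ s → + 𝟙 (0 <ᵇ s)) ≡ coverSum p (suc m) p (λ s → + 𝟙 (1 <ᵇ s)) + + suc m * covering p m p
  atLeastOne = begin
    coverSum p (suc m) p (λ s → + 𝟙 (0 <ᵇ s))
      ≡⟨ coverSum-cong p (suc m) p split ⟩
    coverSum p (suc m) p (λ s → + 𝟙 (1 <ᵇ s) + + 𝟙 (s ≡ᵇ 1))
      ≡⟨ coverSum-+ p (suc m) p _ _ ⟩
    coverSum p (suc m) p (λ s → + 𝟙 (1 <ᵇ s)) + coverSum p (suc m) p (λ s → + 𝟙 (s ≡ᵇ 1))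
      ≡⟨ cong (_+_ (coverSum p (suc m) p (λ s → + 𝟙 (1 <ᵇ s)))) (coverSum-[=1] p (suc m) p) ⟩
    coverSum p (suc m) p (λ s → + 𝟙 (1 <ᵇ s)) + + suc m * covering p m p ∎
    where
    split : ∀ s → + 𝟙 (0 <ᵇ s) ≡ + 𝟙 (1 <ᵇ s) + + 𝟙 (s ≡ᵇ 1)
    split zero          = refl
    split (suc zero)    = refl
    split (suc (suc s)) = refl

eulerianSum-coefficient′ : ∀ i p → let m = i ℕ.+ suc p in
                           eulerianSum m (λ s → (+ m - + s) * + (s C i)) ≡ + O₂ (suc m) (suc p)
eulerianSum-coefficient′ i p = begin
  eulerianSum m (λ s → (+ m - + s) * + (s C i))
    ≡⟨ ∑-cong (λ π → absorb (+ m) (+ asc π) (+ i) _ _ (C-absorption-ℤ (asc π) i)) (perms m) ⟩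
  ∑[ π ∈ perms m ] ((+ m - + i) * + (asc π C i) + (- + suc i) * + (asc π C suc i))
    ≡⟨ ∑-distrib-+ (λ π → (+ m - + i) * + (asc π C i)) (λ π → (- + suc i) * + (asc π C suc i)) (perms m) ⟩
  ∑[ π ∈ perms m ] ((+ m - + i) * + (asc π C i)) + ∑[ π ∈ perms m ] ((- + suc i) * + (asc π C suc i))
    ≡⟨ sym (cong₂ _+_ (*-distribˡ-∑ (+ m - + i) (λ π → + (asc π C i)) (perms m))
                      (*-distribˡ-∑ (- + suc i) (λ π → + (asc π C suc i)) (perms m))) ⟩
  (+ m - + i) * eulerianSum m (λ s → + (s C i)) + (- + suc i) * eulerianSum m (λ s → + (s C suc i))
    ≡⟨ cong₂ (λ a b → (+ m - + i) * a + (- + suc i) * b) (eulerianSum-C≡O m i (suc p) refl)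
                                                         (eulerianSum-C≡O m (suc i) p (sym (ℕ.+-suc i p))) ⟩
  (+ m - + i) * O m (suc p) + (- + suc i) * O m p
    ≡⟨ collect (+ i) (+ p) (O m (suc p)) (O m p) ⟩
  O (suc m) (suc p) - + suc m * O m p
    ≡⟨ sym (O₂-formula m p) ⟩
  + O₂ (suc m) (suc p) ∎
  where
  m = i ℕ.+ suc p
  asc : List ℕ → ℕ
  asc π = ascents (m ∷ π)
  absorb : ∀ m s i c₀ c₁ → (1ℤ + i) * c₁ + i * c₀ ≡ s * c₀ → (m - s) * c₀ ≡ (m - i) * c₀ + (- (1ℤ + i)) * c₁
  absorb m s i c₀ c₁ abs = trans (expand m s c₀) (trans (cong (λ u → m * c₀ - u) (sym abs)) (regroup m i c₀ c₁))
    where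
    expand : ∀ m s c₀ → (m - s) * c₀ ≡ m * c₀ - s * c₀
    expand = solve-∀
    regroup : ∀ m i c₀ c₁ → m * c₀ - ((1ℤ + i) * c₁ + i * c₀) ≡ (m - i) * c₀ + (- (1ℤ + i)) * c₁
    regroup = solve-∀
  collect : ∀ i p a b → (i + (1ℤ + p) - i) * a + (- (1ℤ + i)) * b ≡ (1ℤ + p) * (a + b) - (1ℤ + (i + (1ℤ + p))) * b
  collect = solve-∀

eulerianSum-coefficient : ∀ {m i} → i < m →
                          eulerianSum m (λ s → (+ m - + s) * + (s C i)) ≡ + O₂ (suc m) (suc (m ∸ suc i))
eulerianSum-coefficient {m} {i} i<m =
  subst (λ M → eulerianSum M (λ s → (+ M - + s) * + (s C i)) ≡ + O₂ (suc M) (suc (m ∸ suc i)))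
        (trans (ℕ.+-suc i (m ∸ suc i)) (ℕ.m+[n∸m]≡n i<m))
        (eulerianSum-coefficient′ i (m ∸ suc i))

∑[1‥]≡∑< : ∀ m t → ∑[1‥ m ] t ≡ ∑[ i < m ] t (suc i)
∑[1‥]≡∑< m t = begin
  foldr (λ k acc → t k + acc) 0ℤ [ m ]ₙ  ≡⟨ foldr≡∑ [ m ]ₙ ⟩
  ∑ t [ m ]ₙ                             ≡⟨ cong (∑ t) ([_]ₙ≡range m) ⟩
  ∑ t (range 1 m)                        ≡⟨ ∑-range-suc t 0 m ⟩
  ∑[ i < m ] t (suc i)                   ∎
  where
  foldr≡∑ : ∀ xs → foldr (λ k acc → t k + acc) 0ℤ xs ≡ ∑ t xs
  foldr≡∑ []       = refl
  foldr≡∑ (x ∷ xs) = cong (_+_ (t x)) (foldr≡∑ xs)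

LHS≡eulerianSum : ∀ m x → LHS (suc (suc m)) x ≡ eulerianSum (suc m) (λ s → (+ suc m - + s) * x ^ s)
LHS≡eulerianSum m x = begin
  LHS (suc (suc m)) x
    ≡⟨ ∑[1‥]≡∑< (suc m) (λ k → + (suc (suc m) ∸ k) * + E (suc m) (k ∸ 1) * x ^ (k ∸ 1)) ⟩
  ∑[ j < suc m ] (+ (suc m ∸ j) * + E (suc m) j * x ^ j)
    ≡⟨ ∑<-cong (suc m) (λ j j<1+m → trans (cong (λ c → c * + E (suc m) j * x ^ j) (sym (+-∸ (ℕ.<⇒≤ j<1+m))))
                                            (reorder (+ suc m - + j) (+ E (suc m) j) (x ^ j))) ⟩
  ∑[ j < suc m ] ((+ suc m - + j) * x ^ j * + E (suc m) j)
    ≡⟨ ∑<-E m (λ s → (+ suc m - + s) * x ^ s) ⟩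
  eulerianSum (suc m) (λ s → (+ suc m - + s) * x ^ s) ∎
  where
  reorder : ∀ a e y → a * e * y ≡ a * y * e
  reorder = solve-∀
  +-∸ : ∀ {m s} → s ≤ m → + m - + s ≡ + (m ∸ s)
  +-∸ {m} {s} s≤m = trans (ℤ.m-n≡m⊖n m s) (ℤ.⊖-≥ s≤m)

eulerianSum-binomial : ∀ m (c : ℕ → ℤ) x →
  eulerianSum (suc m) (λ s → c s * x ^ s) ≡ ∑[ i < suc m ] ((x - 1ℤ) ^ i * eulerianSum (suc m) (λ s → c s * + (s C i)))
eulerianSum-binomial m c x = begin
  eulerianSum (suc m) (λ s → c s * x ^ s)
    ≡⟨ eulerianSum-cong m (λ s s≤m → cong (c s *_) (trans (cong (_^ s) (x≡1+y x)) (binomial-expansion y s (suc m) (s≤s s≤m)))) ⟩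
  eulerianSum (suc m) (λ s → c s * ∑[ i < suc m ] (+ (s C i) * y ^ i))
    ≡⟨ ∑-cong (λ π → trans (*-distribˡ-∑ (c (asc π)) _ (range 0 (suc m)))
                           (∑-cong (λ i → swap (c (asc π)) _ (y ^ i)) (range 0 (suc m)))) (perms (suc m)) ⟩
  ∑[ π ∈ perms (suc m) ] ∑[ i < suc m ] (y ^ i * (c (asc π) * + (asc π C i)))
    ≡⟨ ∑-comm (λ π i → y ^ i * (c (asc π) * + (asc π C i))) (perms (suc m)) (range 0 (suc m)) ⟩
  ∑[ i < suc m ] ∑[ π ∈ perms (suc m) ] (y ^ i * (c (asc π) * + (asc π C i)))
    ≡⟨ ∑-cong (λ i → sym (*-distribˡ-∑ (y ^ i) (λ π → c (asc π) * + (asc π C i)) (perms (suc m)))) (range 0 (suc m)) ⟩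
  ∑[ i < suc m ] (y ^ i * eulerianSum (suc m) (λ s → c s * + (s C i))) ∎
  where
  y = x - 1ℤ
  asc : List ℕ → ℕ
  asc π = ascents (suc m ∷ π)
  x≡1+y : ∀ x → x ≡ 1ℤ + (x - 1ℤ)
  x≡1+y = solve-∀
  swap : ∀ a b z → a * (b * z) ≡ z * (a * b)
  swap = solve-∀

RHS≡∑ : ∀ m x → RHS (suc m) x ≡ ∑[ i < m ] ((x - 1ℤ) ^ i * + O₂ (suc m) (suc (m ∸ suc i)))
RHS≡∑ m x = begin
  RHS (suc m) x
    ≡⟨ ∑[1‥]≡∑< m (λ ℓ → + O₂ (suc m) ℓ * (x - 1ℤ) ^ (suc m ∸ ℓ ∸ 1)) ⟩
  ∑[ k < m ] (+ O₂ (suc m) (suc k) * (x - 1ℤ) ^ (m ∸ k ∸ 1))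
    ≡⟨ ∑<-reverse m (λ k → + O₂ (suc m) (suc k) * (x - 1ℤ) ^ (m ∸ k ∸ 1)) ⟩
  ∑[ i < m ] (+ O₂ (suc m) (suc (m ∸ suc i)) * (x - 1ℤ) ^ (m ∸ (m ∸ suc i) ∸ 1))
    ≡⟨ ∑<-cong m (λ i i<m → trans (cong (λ e → + O₂ (suc m) (suc (m ∸ suc i)) * (x - 1ℤ) ^ (e ∸ 1)) (ℕ.m∸[m∸n]≡n i<m))
                                  (ℤ.*-comm (+ O₂ (suc m) (suc (m ∸ suc i))) ((x - 1ℤ) ^ i))) ⟩
  ∑[ i < m ] ((x - 1ℤ) ^ i * + O₂ (suc m) (suc (m ∸ suc i))) ∎

theorem1 : (n : ℕ) → 2 ≤ n → (x : ℤ) → LHS n x ≡ RHS n x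
theorem1 (suc zero)    (s≤s ()) x
theorem1 (suc (suc m)) _        x = begin
  LHS (suc (suc m)) x
    ≡⟨ LHS≡eulerianSum m x ⟩
  eulerianSum (suc m) (λ s → (+ suc m - + s) * x ^ s)
    ≡⟨ eulerianSum-binomial m (λ s → + suc m - + s) x ⟩
  ∑[ i < suc m ] ((x - 1ℤ) ^ i * eulerianSum (suc m) (λ s → (+ suc m - + s) * + (s C i)))
    ≡⟨ ∑<-cong (suc m) (λ i i<1+m → cong ((x - 1ℤ) ^ i *_) (eulerianSum-coefficient i<1+m)) ⟩
  ∑[ i < suc m ] ((x - 1ℤ) ^ i * + O₂ (suc (suc m)) (suc (suc m ∸ suc i)))
    ≡⟨ sym (RHS≡∑ (suc m) x) ⟩
  RHS (suc (suc m)) x ∎
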